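{- For $n\ge 4$, the statistics $\operatorname{inv}_D$ and $\operatorname{sor}_D$ are equidistributed over $D_n$: \[ \sum_{w\in D_n} q^{\operatorname{inv}_D(w)} = \sum_{w\in D_n} q^{\operatorname{sor}_D(w)}. \]
   Context: $D_n$ is the subgroup of signed permutations of $\{\pm1,\ldots,\pm n\}$ (bijections with $w(-i)=-w(i)$, $w=w_1\cdots w_n$, product $(uv)(x)=u(v(x))$) with an even number of negative entries among $w_1,\ldots,w_n$; $\bar i=-i$. $\operatorname{inv}_D(w) = |\{1\le i<j\le n : w(i)>w(j)\}| + |\{1\le i<j\le n : -w(i)>w(j)\}|$. For $i\ne\pm j$, $t_{ij}$ exchanges $i\leftrightarrow j$ and $-i\leftrightarrow -j$, fixing all else; for $2\le j\le n$, $t_{\bar j j}$ denotes the element negating $1$ and $j$ and fixing all else. Every $w\in D_n$ has a unique factorization $w=t_{i_1j_1}\cdots t_{i_kj_k}$ with $1<j_1<\cdots<j_k$ and $i_s\in\{ -j_s,\ldots,j_s-1\}\setminus\{0\}$, and $\operatorname{sor}_D(w)=\sum_{s}\bigl(j_s-i_s-2\chi(i_s<0)\bigr)$. -}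

module Defs where

open import Data.Bool using (Bool; true; false; _∧_; _∨_; not; if_then_else_; T)
open import Data.Nat as ℕ using (ℕ; zero; suc)
open import Data.Integer as ℤ using (ℤ; +_; -_; ∣_∣)
open import Data.List using (List; []; _∷_; upTo; map; foldr)
open import Data.Vec as Vec using (Vec; tabulate; toList)
open import Data.Fin using (Fin; toℕ)
open import Data.Product using (Σ; _×_; _,_; proj₁)
open import Relation.Binary.PropositionalEquality using (_≡_)

infix 4 _==ℤ_ _<ℤ_

allᵇ : {A : Set} → (A → Bool) → List A → Bool
allᵇ p []       = true
allᵇ p (x ∷ xs) = p x ∧ allᵇ p xs

_==ℤ_ : ℤ → ℤ → Bool
x ==ℤ y = (x ℤ.≤ᵇ y) ∧ (y ℤ.≤ᵇ x)

_<ℤ_ : ℤ → ℤ → Bool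
x <ℤ y = not (y ℤ.≤ᵇ x)

countᵇ : {A : Set} → (A → Bool) → List A → ℕ
countᵇ p []       = 0
countᵇ p (x ∷ xs) = (if p x then 1 else 0) ℕ.+ countᵇ p xs

evenᵇ : ℕ → Bool
evenᵇ zero          = true
evenᵇ (suc zero)    = false
evenᵇ (suc (suc m)) = evenᵇ m

-- Signed permutations in window notation: w is the vector (w₁,…,wₙ)
-- of values w(1),…,w(n) ∈ {±1,…,±n}; w(-i) = -w(i) is implicit.

isSignedPerm : (n : ℕ) → Vec ℤ n → Bool
isSignedPerm n w =
  allᵇ (λ x → (1 ℕ.≤ᵇ ∣ x ∣) ∧ (∣ x ∣ ℕ.≤ᵇ n)) (toList w)
  ∧ allᵇ (λ j → countᵇ (λ x → ∣ x ∣ ℕ.≡ᵇ suc j) (toList w) ℕ.≡ᵇ 1) (upTo n)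

negCount : {n : ℕ} → Vec ℤ n → ℕ
negCount w = countᵇ (λ x → x <ℤ + 0) (toList w)

isDn : (n : ℕ) → Vec ℤ n → Bool
isDn n w = isSignedPerm n w ∧ evenᵇ (negCount w)

-- the group D_n (as a set; T of a boolean is proof-irrelevant)
D : ℕ → Set
D n = Σ (Vec ℤ n) (λ w → T (isDn n w))

-- inv_D(w) = #{i<j : w(i) > w(j)} + #{i<j : -w(i) > w(j)}

invL : List ℤ → ℕ
invL []       = 0
invL (x ∷ xs) = countᵇ (λ y → y <ℤ x) xs ℕ.+ countᵇ (λ y → y <ℤ (- x)) xs ℕ.+ invL xs

invD : {n : ℕ} → Vec ℤ n → ℕ
invD w = invL (toList w)

-- Reflections t_{ij}.  A factor is a pair (i , j) with i ∈ ℤ, j ∈ ℕ.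
-- If i ≠ -j: t_{ij} exchanges i ↔ j and -i ↔ -j, fixing all else.
-- If i = -j: t_{\bar j j} negates 1 and j, fixing all else.

Factor : Set
Factor = ℤ × ℕ

tAct : Factor → ℤ → ℤ
tAct (i , j) x with i ==ℤ (- (+ j))
... | false =
  if x ==ℤ i then + j
  else if x ==ℤ (+ j) then i
  else if x ==ℤ (- i) then - (+ j)
  else if x ==ℤ (- (+ j)) then - i
  else x
... | true =
  if x ==ℤ (+ 1) then - (+ 1)
  else if x ==ℤ (- (+ 1)) then + 1
  else if x ==ℤ (+ j) then - (+ j)
  else if x ==ℤ (- (+ j)) then + j
  else x

-- product t_{i₁j₁} ⋯ t_{i_kj_k} applied to x, with (uv)(x) = u(v(x))
prodAct : List Factor → ℤ → ℤ
prodAct fs x = foldr tAct x fs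

prodVec : (n : ℕ) → List Factor → Vec ℤ n
prodVec n fs = tabulate (λ p → prodAct fs (+ suc (toℕ p)))

validFrom : ℕ → ℕ → List Factor → Bool
validFrom n prev []             = true
validFrom n prev ((i , j) ∷ fs) =
  (prev ℕ.<ᵇ j) ∧ (j ℕ.≤ᵇ n)
  ∧ ((- (+ j)) ℤ.≤ᵇ i) ∧ (i <ℤ (+ j)) ∧ not (i ==ℤ + 0)
  ∧ validFrom n j fs

validFact : ℕ → List Factor → Bool
validFact n fs = validFrom n 1 fs

sorCost : List Factor → ℤ
sorCost []             = + 0
sorCost ((i , j) ∷ fs) =
  ((+ j) ℤ.- i ℤ.- (if i <ℤ + 0 then + 2 else + 0)) ℤ.+ sorCost fs

-- The set {w ∈ D_n : sor_D(w) = k}, with the factorization recorded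
-- (it is unique, so this set is in bijection with that of the paper).
SorFiber : ℕ → ℕ → Set
SorFiber n k =
  Σ (D n) (λ w → Σ (List Factor) (λ fs →
    T (validFact n fs) × (prodVec n fs ≡ proj₁ w) × (sorCost fs ≡ + k)))

InvFiber : ℕ → ℕ → Set
InvFiber n k = Σ (D n) (λ w → invD (proj₁ w) ≡ k)

-- Both generating functions are products over the levels j = 2, …, n of the same factor.
-- Recording the last entry ±(r+1) of a signed permutation and recursing on the remaining entries,
-- with the magnitude r+1 punched out, codes signed permutations of length n bijectively by options
-- (s_j , r_j) ∈ Bool × {0, …, j-1} at the levels j = 1, …, n; the last entry at level j forms
-- j-1-r (if positive) or j-1+r (if negative) inversions with the earlier ones.  For D_n the sign
-- at level 1 is determined by the parity of the others, and level 1 has weight 0.  An admissible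
-- factorization chooses, independently at each level j ≥ 2, no factor or one factor t_{ij}, and
-- these choices are the same options with the same weights: none for (false , j-1), t_{r+1,j}
-- with cost j-1-r and t_{-(r+1),j} with cost j-1+r.  Every such product lies in D_n, since each
-- factor permutes magnitudes and changes an even number of signs.

module Submission where

open import Defs
open import Algebra using (CommutativeRing)
open import Axiom.UniquenessOfIdentityProofs using (module Decidable⇒UIP)
open import Data.Bool using (Bool; true; false; _∧_; _∨_; not; if_then_else_; T; _xor_)
open import Data.Bool.Properties
  using (T-irrelevant; ∨-zeroʳ; not-injective; xor-identityʳ; xor-∧-commutativeRing)
open import Data.Nat as ℕ
  using (ℕ; zero; suc; _+_; _∸_; _≤_; _<_; z≤n; s≤s; s≤s⁻¹; pred; _≤ᵇ_; _<ᵇ_; _≡ᵇ_; _<?_; _≟_; _≤?_)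
open import Data.Nat.Properties
open import Data.Integer as ℤ using (ℤ; +_; -[1+_]; -_; ∣_∣)
import Data.Integer.Properties as ℤ
open import Data.List as List using (List; []; _∷_; _++_; length)
open import Data.List.Properties using (length-map; length-++)
open import Data.List.Relation.Unary.All as All using (All; []; _∷_)
open import Data.List.Relation.Unary.All.Properties using (++⁺; map⁺; ++⁻ˡ; ++⁻ʳ; applyUpTo⁺₁; applyUpTo⁻)
open import Data.Vec as Vec using (Vec; []; _∷_; _∷ʳ_; toList; init; last; initLast; tabulate)
open import Data.Vec.Properties
  using (toList-∷ʳ; toList-map; init-∷ʳ; last-∷ʳ; length-toList; tabulate-cong; tabulate-∘)
open import Data.Fin using (Fin; zero; suc; toℕ; fromℕ)
open import Data.Fin.Properties using (toℕ≤pred[n]; toℕ-fromℕ; toℕ-injective)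
open import Data.Product using (Σ; _×_; _,_; proj₁; proj₂)
open import Data.Unit using (⊤; tt)
open import Data.Empty using (⊥-elim)
open import Function using (_∘_; flip)
open import Function.Bundles using (_↔_; Inverse; mk↔ₛ′)
open import Function.Properties.Inverse using (↔-trans; ↔-refl; ↔-sym)
open import Data.Product.Function.NonDependent.Propositional using (_×-↔_)
open import Relation.Nullary using (¬_; yes; no; Dec)
open import Relation.Binary.PropositionalEquality
open import Data.Nat.Solver using (module +-*-Solver)

open import Algebra.Properties.CommutativeSemigroup +-commutativeSemigroup
  using () renaming (interchange to +-interchange)
open import Algebra.Properties.CommutativeSemigroup
  (CommutativeRing.+-commutativeSemigroup xor-∧-commutativeRing)
  using () renaming (interchange to xor-interchange)

χ : Bool → ℕ
χ b = if b then 1 else 0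

T⇒≡ : ∀ {b} → T b → b ≡ true
T⇒≡ {true} _ = refl

≡⇒T : ∀ {b} → b ≡ true → T b
≡⇒T refl = tt

true⇔⇒≡ : ∀ a b → (a ≡ true → b ≡ true) → (b ≡ true → a ≡ true) → a ≡ b
true⇔⇒≡ false false _ _ = refl
true⇔⇒≡ false true  _ g = g refl
true⇔⇒≡ true  false f _ = sym (f refl)
true⇔⇒≡ true  true  _ _ = refl

¬true⇒false : ∀ {b} → ¬ b ≡ true → b ≡ false
¬true⇒false {false} _ = refl
¬true⇒false {true}  h = ⊥-elim (h refl)

true≢false : true ≢ false
true≢false ()

∧-true : ∀ {a b} → (a ∧ b) ≡ true → a ≡ true × b ≡ true
∧-true {true} e = refl , e

true-∧ : ∀ {a b} → a ≡ true → b ≡ true → (a ∧ b) ≡ true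
true-∧ refl refl = refl

≤ᵇ-true : ∀ {m n} → m ≤ n → (m ≤ᵇ n) ≡ true
≤ᵇ-true = T⇒≡ ∘ ≤⇒≤ᵇ

≤ᵇ-true⁻ : ∀ {m n} → (m ≤ᵇ n) ≡ true → m ≤ n
≤ᵇ-true⁻ {m} {n} = ≤ᵇ⇒≤ m n ∘ ≡⇒T

≤ᵇ-false : ∀ {m n} → ¬ m ≤ n → (m ≤ᵇ n) ≡ false
≤ᵇ-false h = ¬true⇒false (h ∘ ≤ᵇ-true⁻)

<ᵇ-true : ∀ {m n} → m < n → (m <ᵇ n) ≡ true
<ᵇ-true = T⇒≡ ∘ <⇒<ᵇ

<ᵇ-true⁻ : ∀ {m n} → (m <ᵇ n) ≡ true → m < n
<ᵇ-true⁻ {m} {n} = <ᵇ⇒< m n ∘ ≡⇒T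

<ᵇ-false : ∀ {m n} → ¬ m < n → (m <ᵇ n) ≡ false
<ᵇ-false h = ¬true⇒false (h ∘ <ᵇ-true⁻)

≡ᵇ-true : ∀ {m n} → m ≡ n → (m ≡ᵇ n) ≡ true
≡ᵇ-true {m} {n} = T⇒≡ ∘ ≡⇒≡ᵇ m n

≡ᵇ-true⁻ : ∀ {m n} → (m ≡ᵇ n) ≡ true → m ≡ n
≡ᵇ-true⁻ {m} {n} = ≡ᵇ⇒≡ m n ∘ ≡⇒T

≡ᵇ-false : ∀ {m n} → m ≢ n → (m ≡ᵇ n) ≡ false
≡ᵇ-false h = ¬true⇒false (h ∘ ≡ᵇ-true⁻)

≡ᵇ-refl : ∀ n → (n ≡ᵇ n) ≡ true
≡ᵇ-refl n = ≡ᵇ-true {n} refl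

not-≤ᵇ : ∀ m n → not (m ≤ᵇ n) ≡ (n <ᵇ m)
not-≤ᵇ m n with m ≤? n
... | yes m≤n rewrite ≤ᵇ-true m≤n = sym (<ᵇ-false (≤⇒≯ m≤n))
... | no m≰n rewrite ≤ᵇ-false m≰n = sym (<ᵇ-true (≰⇒> m≰n))

<ᵇ-suc : ∀ r a → (r <ᵇ suc a) ≡ (r ≤ᵇ a)
<ᵇ-suc r a = true⇔⇒≡ _ _
  (λ e → ≤ᵇ-true (s≤s⁻¹ (<ᵇ-true⁻ {r} {suc a} e))) (λ e → <ᵇ-true (s≤s (≤ᵇ-true⁻ {r} {a} e)))

suc-≤ᵇ : ∀ m n → (suc m ≤ᵇ suc n) ≡ (m ≤ᵇ n)
suc-≤ᵇ m n = true⇔⇒≡ _ _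
  (λ e → ≤ᵇ-true (s≤s⁻¹ (≤ᵇ-true⁻ {suc m} {suc n} e))) (λ e → ≤ᵇ-true (s≤s (≤ᵇ-true⁻ {m} {n} e)))

module _ {A : Set} where

  countᵇ-++ : (p : A → Bool) (xs ys : List A) → countᵇ p (xs ++ ys) ≡ countᵇ p xs + countᵇ p ys
  countᵇ-++ p []       ys = refl
  countᵇ-++ p (x ∷ xs) ys = trans (cong (_+_ (χ (p x))) (countᵇ-++ p xs ys)) (sym (+-assoc (χ (p x)) _ _))

  countᵇ-map : {B : Set} (p : B → Bool) (f : A → B) (xs : List A) →
               countᵇ p (List.map f xs) ≡ countᵇ (p ∘ f) xs
  countᵇ-map p f []       = refl
  countᵇ-map p f (x ∷ xs) = cong (_+_ (χ (p (f x)))) (countᵇ-map p f xs)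

  countᵇ-cong : {p q : A → Bool} {xs : List A} → All (λ x → p x ≡ q x) xs → countᵇ p xs ≡ countᵇ q xs
  countᵇ-cong [] = refl
  countᵇ-cong (e ∷ es) = cong₂ _+_ (cong χ e) (countᵇ-cong es)

  countᵇ-none : {p : A → Bool} {xs : List A} → All (λ x → p x ≡ false) xs → countᵇ p xs ≡ 0
  countᵇ-none [] = refl
  countᵇ-none (e ∷ es) rewrite e = countᵇ-none es

  countᵇ-none⁻ : (p : A → Bool) (xs : List A) → countᵇ p xs ≡ 0 → All (λ x → p x ≡ false) xs
  countᵇ-none⁻ p []       _ = []
  countᵇ-none⁻ p (x ∷ xs) e with p x in px
  ... | false = px ∷ countᵇ-none⁻ p xs e

  countᵇ-all : (xs : List A) → countᵇ (λ _ → true) xs ≡ length xs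
  countᵇ-all []       = refl
  countᵇ-all (_ ∷ xs) = cong suc (countᵇ-all xs)

  countᵇ-false : (xs : List A) → countᵇ (λ _ → false) xs ≡ 0
  countᵇ-false xs = countᵇ-none (All.universal (λ _ → refl) xs)

  countᵇ-+-cong : {p q p′ q′ : A → Bool} {xs : List A} →
                  All (λ x → χ (p x) + χ (q x) ≡ χ (p′ x) + χ (q′ x)) xs →
                  countᵇ p xs + countᵇ q xs ≡ countᵇ p′ xs + countᵇ q′ xs
  countᵇ-+-cong [] = refl
  countᵇ-+-cong {p} {q} {p′} {q′} {x ∷ xs} (e ∷ es) = begin
    (χ (p x) + countᵇ p xs) + (χ (q x) + countᵇ q xs)     ≡⟨ +-interchange (χ (p x)) _ (χ (q x)) _ ⟩
    (χ (p x) + χ (q x)) + (countᵇ p xs + countᵇ q xs)     ≡⟨ cong₂ _+_ e (countᵇ-+-cong es) ⟩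
    (χ (p′ x) + χ (q′ x)) + (countᵇ p′ xs + countᵇ q′ xs) ≡⟨ +-interchange (χ (p′ x)) _ (countᵇ p′ xs) _ ⟩
    (χ (p′ x) + countᵇ p′ xs) + (χ (q′ x) + countᵇ q′ xs) ∎
    where open ≡-Reasoning

  allᵇ⇒All : (p : A → Bool) (xs : List A) → allᵇ p xs ≡ true → All (λ x → p x ≡ true) xs
  allᵇ⇒All p []       _ = []
  allᵇ⇒All p (x ∷ xs) e = proj₁ (∧-true e) ∷ allᵇ⇒All p xs (proj₂ (∧-true e))

  All⇒allᵇ : (p : A → Bool) (xs : List A) → All (λ x → p x ≡ true) xs → allᵇ p xs ≡ true
  All⇒allᵇ p []       []       = refl
  All⇒allᵇ p (x ∷ xs) (e ∷ es) = true-∧ e (All⇒allᵇ p xs es)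

punchIn : ℕ → ℕ → ℕ
punchIn r a = if a <ᵇ r then a else suc a

punchOut : ℕ → ℕ → ℕ
punchOut r a = if a <ᵇ r then a else pred a

punchIn-< : ∀ {r a} → a < r → punchIn r a ≡ a
punchIn-< p rewrite <ᵇ-true p = refl

punchIn-≮ : ∀ {r a} → ¬ a < r → punchIn r a ≡ suc a
punchIn-≮ p rewrite <ᵇ-false p = refl

punchOut-< : ∀ {r a} → a < r → punchOut r a ≡ a
punchOut-< p rewrite <ᵇ-true p = refl

punchOut-≮ : ∀ {r a} → ¬ a < r → punchOut r a ≡ pred a
punchOut-≮ p rewrite <ᵇ-false p = refl

punchOut-punchIn : ∀ r a → punchOut r (punchIn r a) ≡ a
punchOut-punchIn r a with a <? r
... | yes a<r rewrite punchIn-< a<r = punchOut-< a<r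
... | no a≮r rewrite punchIn-≮ a≮r = punchOut-≮ (a≮r ∘ <-trans (n<1+n a))

punchIn-punchOut : ∀ {r a} → a ≢ r → punchIn r (punchOut r a) ≡ a
punchIn-punchOut {r} {a} a≢r with a <? r
... | yes a<r rewrite punchOut-< a<r = punchIn-< a<r
punchIn-punchOut {r} {zero}  a≢r | no a≮r = ⊥-elim (a≮r (n≢0⇒n>0 (a≢r ∘ sym)))
punchIn-punchOut {r} {suc a} a≢r | no a≮r rewrite punchOut-≮ a≮r =
  punchIn-≮ (λ a<r → a≢r (≤-antisym a<r (≮⇒≥ a≮r)))

punchIn≢ : ∀ r a → punchIn r a ≢ r
punchIn≢ r a with a <? r
... | yes a<r rewrite punchIn-< a<r = <⇒≢ a<r
... | no a≮r rewrite punchIn-≮ a≮r = λ a+1≡r → a≮r (≤-reflexive a+1≡r)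

punchIn-≡ᵇ : ∀ r a {j} → j ≢ r → (punchIn r a ≡ᵇ j) ≡ (a ≡ᵇ punchOut r j)
punchIn-≡ᵇ r a j≢r = true⇔⇒≡ _ _
  (λ e → ≡ᵇ-true (trans (sym (punchOut-punchIn r a)) (cong (punchOut r) (≡ᵇ-true⁻ e))))
  (λ e → ≡ᵇ-true (trans (cong (punchIn r) (≡ᵇ-true⁻ e)) (punchIn-punchOut j≢r)))

punchOut-≡ᵇ : ∀ r {a} j → a ≢ r → (punchOut r a ≡ᵇ j) ≡ (a ≡ᵇ punchIn r j)
punchOut-≡ᵇ r j a≢r = true⇔⇒≡ _ _
  (λ e → ≡ᵇ-true (trans (sym (punchIn-punchOut a≢r)) (cong (punchIn r) (≡ᵇ-true⁻ e))))
  (λ e → ≡ᵇ-true (trans (cong (punchOut r) (≡ᵇ-true⁻ e)) (punchOut-punchIn r j)))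

punchIn-mono-≤ : ∀ r {a b} → a ≤ b → punchIn r a ≤ punchIn r b
punchIn-mono-≤ r {a} {b} a≤b with a <? r | b <? r
... | yes a<r | yes b<r rewrite punchIn-< a<r | punchIn-< b<r = a≤b
... | yes a<r | no b≮r rewrite punchIn-< a<r | punchIn-≮ b≮r = m≤n⇒m≤1+n a≤b
... | no a≮r  | yes b<r = ⊥-elim (a≮r (≤-<-trans a≤b b<r))
... | no a≮r  | no b≮r rewrite punchIn-≮ a≮r | punchIn-≮ b≮r = s≤s a≤b

punchIn-cancel-≤ : ∀ r {a b} → punchIn r a ≤ punchIn r b → a ≤ b
punchIn-cancel-≤ r {a} {b} h with a <? r | b <? r
... | yes a<r | yes b<r rewrite punchIn-< a<r | punchIn-< b<r = h
... | yes a<r | no b≮r = ≤-trans (<⇒≤ a<r) (≮⇒≥ b≮r)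
... | no a≮r  | yes b<r rewrite punchIn-≮ a≮r | punchIn-< b<r = ⊥-elim (a≮r (<-≤-trans h (<⇒≤ b<r)))
... | no a≮r  | no b≮r rewrite punchIn-≮ a≮r | punchIn-≮ b≮r = s≤s⁻¹ h

punchIn-≤ᵇ : ∀ r a b → (punchIn r a ≤ᵇ punchIn r b) ≡ (a ≤ᵇ b)
punchIn-≤ᵇ r a b = true⇔⇒≡ _ _
  (≤ᵇ-true ∘ punchIn-cancel-≤ r ∘ ≤ᵇ-true⁻) (≤ᵇ-true ∘ punchIn-mono-≤ r ∘ ≤ᵇ-true⁻)

<ᵇ-punchIn : ∀ r a → (r <ᵇ punchIn r a) ≡ (r ≤ᵇ a)
<ᵇ-punchIn r a with a <? r
... | yes a<r rewrite punchIn-< a<r = trans (<ᵇ-false (<-asym a<r)) (sym (≤ᵇ-false (<⇒≱ a<r)))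
... | no a≮r rewrite punchIn-≮ a≮r = trans (<ᵇ-true (s≤s (≮⇒≥ a≮r))) (sym (≤ᵇ-true (≮⇒≥ a≮r)))

punchIn-<ᵇ : ∀ r a → (punchIn r a <ᵇ r) ≡ (a <ᵇ r)
punchIn-<ᵇ r a with a <? r
... | yes a<r rewrite punchIn-< a<r = refl
... | no a≮r rewrite punchIn-≮ a≮r = trans (<ᵇ-false (a≮r ∘ <-trans (n<1+n a))) (sym (<ᵇ-false a≮r))

punchIn-bounded : ∀ r {a m} → a < m → punchIn r a < suc m
punchIn-bounded r {a} a<m with a <? r
... | yes a<r rewrite punchIn-< a<r = m≤n⇒m≤1+n a<m
... | no a≮r rewrite punchIn-≮ a≮r = s≤s a<m

punchOut-bounded : ∀ {r a m} → a < suc m → a ≢ r → r ≤ m → punchOut r a < m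
punchOut-bounded {r} {a} a<1+m a≢r r≤m with a <? r
... | yes a<r rewrite punchOut-< a<r = <-≤-trans a<r r≤m
punchOut-bounded {r} {zero}  a<1+m a≢r r≤m | no a≮r = ⊥-elim (a≢r (sym (n≤0⇒n≡0 (≮⇒≥ a≮r))))
punchOut-bounded {r} {suc a} a<1+m a≢r r≤m | no a≮r rewrite punchOut-≮ a≮r = s≤s⁻¹ a<1+m

punchInℤ : ℕ → ℤ → ℤ
punchInℤ r (+ zero)  = + zero
punchInℤ r (+ suc a) = + suc (punchIn r a)
punchInℤ r -[1+ a ]  = -[1+ punchIn r a ]

punchOutℤ : ℕ → ℤ → ℤ
punchOutℤ r (+ zero)  = + zero
punchOutℤ r (+ suc a) = + suc (punchOut r a)
punchOutℤ r -[1+ a ]  = -[1+ punchOut r a ]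

punchOutℤ-punchInℤ : ∀ r x → punchOutℤ r (punchInℤ r x) ≡ x
punchOutℤ-punchInℤ r (+ zero)  = refl
punchOutℤ-punchInℤ r (+ suc a) = cong (λ b → + suc b) (punchOut-punchIn r a)
punchOutℤ-punchInℤ r -[1+ a ]  = cong -[1+_] (punchOut-punchIn r a)

punchInℤ-punchOutℤ : ∀ {r} x → ∣ x ∣ ≢ suc r → punchInℤ r (punchOutℤ r x) ≡ x
punchInℤ-punchOutℤ (+ zero)  _ = refl
punchInℤ-punchOutℤ (+ suc a) h = cong (λ b → + suc b) (punchIn-punchOut (h ∘ cong suc))
punchInℤ-punchOutℤ -[1+ a ]  h = cong -[1+_] (punchIn-punchOut (h ∘ cong suc))

-‿punchInℤ : ∀ r x → - punchInℤ r x ≡ punchInℤ r (- x)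
-‿punchInℤ r (+ zero)  = refl
-‿punchInℤ r (+ suc a) = refl
-‿punchInℤ r -[1+ a ]  = refl

punchInℤ-≤ᵇ : ∀ r x y → (punchInℤ r x ℤ.≤ᵇ punchInℤ r y) ≡ (x ℤ.≤ᵇ y)
punchInℤ-≤ᵇ r (+ zero)  (+ zero)  = refl
punchInℤ-≤ᵇ r (+ zero)  (+ suc b) = refl
punchInℤ-≤ᵇ r (+ zero)  -[1+ b ]  = refl
punchInℤ-≤ᵇ r (+ suc a) (+ zero)  = refl
punchInℤ-≤ᵇ r (+ suc a) (+ suc b) =
  trans (suc-≤ᵇ (punchIn r a) (punchIn r b)) (trans (punchIn-≤ᵇ r a b) (sym (suc-≤ᵇ a b)))
punchInℤ-≤ᵇ r (+ suc a) -[1+ b ]  = refl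
punchInℤ-≤ᵇ r -[1+ a ]  (+ zero)  = refl
punchInℤ-≤ᵇ r -[1+ a ]  (+ suc b) = refl
punchInℤ-≤ᵇ r -[1+ a ]  -[1+ b ]  = punchIn-≤ᵇ r b a

punchInℤ-<0 : ∀ r x → (punchInℤ r x <ℤ + 0) ≡ (x <ℤ + 0)
punchInℤ-<0 r (+ zero)  = refl
punchInℤ-<0 r (+ suc a) = refl
punchInℤ-<0 r -[1+ a ]  = refl

∣punchInℤ∣-≡ᵇ : ∀ r x {j} → j ≢ r → (∣ punchInℤ r x ∣ ≡ᵇ suc j) ≡ (∣ x ∣ ≡ᵇ suc (punchOut r j))
∣punchInℤ∣-≡ᵇ r (+ zero)  j≢r = refl
∣punchInℤ∣-≡ᵇ r (+ suc a) j≢r = punchIn-≡ᵇ r a j≢r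
∣punchInℤ∣-≡ᵇ r -[1+ a ]  j≢r = punchIn-≡ᵇ r a j≢r

∣punchInℤ∣≢ : ∀ r x → (∣ punchInℤ r x ∣ ≡ᵇ suc r) ≡ false
∣punchInℤ∣≢ r (+ zero)  = refl
∣punchInℤ∣≢ r (+ suc a) = ≡ᵇ-false (punchIn≢ r a)
∣punchInℤ∣≢ r -[1+ a ]  = ≡ᵇ-false (punchIn≢ r a)

∣punchOutℤ∣-≡ᵇ : ∀ r x j → ∣ x ∣ ≢ suc r → (∣ punchOutℤ r x ∣ ≡ᵇ suc j) ≡ (∣ x ∣ ≡ᵇ suc (punchIn r j))
∣punchOutℤ∣-≡ᵇ r (+ zero)  j _ = refl
∣punchOutℤ∣-≡ᵇ r (+ suc a) j h = punchOut-≡ᵇ r j (h ∘ cong suc)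
∣punchOutℤ∣-≡ᵇ r -[1+ a ]  j h = punchOut-≡ᵇ r j (h ∘ cong suc)

inversionsWith : ℤ → List ℤ → ℕ
inversionsWith z xs = countᵇ (z <ℤ_) xs + countᵇ (λ x → z <ℤ - x) xs

invL-∷ʳ : ∀ xs z → invL (xs ++ z ∷ []) ≡ invL xs + inversionsWith z xs
invL-∷ʳ []       z = refl
invL-∷ʳ (x ∷ xs) z
  rewrite countᵇ-++ (_<ℤ x) xs (z ∷ []) | countᵇ-++ (_<ℤ - x) xs (z ∷ []) | invL-∷ʳ xs z =
  solve 7 (λ a b c d e f g → (a :+ (b :+ con 0)) :+ (c :+ (d :+ con 0)) :+ (e :+ (f :+ g))
                           := (a :+ c :+ e) :+ ((b :+ f) :+ (d :+ g))) refl
    (countᵇ (_<ℤ x) xs) (χ (z <ℤ x)) (countᵇ (_<ℤ - x) xs) (χ (z <ℤ - x)) (invL xs)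
    (countᵇ (z <ℤ_) xs) (countᵇ (λ y → z <ℤ - y) xs)
  where open +-*-Solver

invL-punchInℤ : ∀ r xs → invL (List.map (punchInℤ r) xs) ≡ invL xs
invL-punchInℤ r []       = refl
invL-punchInℤ r (x ∷ xs) = cong₂ _+_ (cong₂ _+_ below below-neg) (invL-punchInℤ r xs)
  where
  below : countᵇ (_<ℤ punchInℤ r x) (List.map (punchInℤ r) xs) ≡ countᵇ (_<ℤ x) xs
  below = trans (countᵇ-map _ (punchInℤ r) xs)
                (countᵇ-cong (All.universal (λ y → cong not (punchInℤ-≤ᵇ r x y)) xs))
  below-neg : countᵇ (_<ℤ - punchInℤ r x) (List.map (punchInℤ r) xs) ≡ countᵇ (_<ℤ - x) xs
  below-neg = trans (countᵇ-map _ (punchInℤ r) xs) (countᵇ-cong (All.universal (λ y →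
    cong not (trans (cong (ℤ._≤ᵇ punchInℤ r y) (-‿punchInℤ r x)) (punchInℤ-≤ᵇ r (- x) y))) xs))

inRangeᵇ : ℕ → ℤ → Bool
inRangeᵇ m y = (1 ≤ᵇ ∣ y ∣) ∧ (∣ y ∣ ≤ᵇ m)

multiplicity : ℕ → List ℤ → ℕ
multiplicity v = countᵇ (λ x → ∣ x ∣ ≡ᵇ v)

record SignedPerm (m : ℕ) (ws : List ℤ) : Set where
  field
    length≡ : length ws ≡ m
    inRange : All (λ y → inRangeᵇ m y ≡ true) ws
    once    : ∀ j → j < m → multiplicity (suc j) ws ≡ 1

module _ {m : ℕ} where

  inRange-1≤ : ∀ y → inRangeᵇ m y ≡ true → 1 ≤ ∣ y ∣
  inRange-1≤ y = ≤ᵇ-true⁻ {1} ∘ proj₁ ∘ ∧-true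

  inRange-≤ : ∀ y → inRangeᵇ m y ≡ true → ∣ y ∣ ≤ m
  inRange-≤ y = ≤ᵇ-true⁻ {∣ y ∣} ∘ proj₂ ∘ ∧-true {1 ≤ᵇ ∣ y ∣}

  inRange-intro : ∀ y → 1 ≤ ∣ y ∣ → ∣ y ∣ ≤ m → inRangeᵇ m y ≡ true
  inRange-intro y 1≤y y≤m = true-∧ (≤ᵇ-true 1≤y) (≤ᵇ-true y≤m)

isSignedPerm⇒SignedPerm : ∀ n (w : Vec ℤ n) → isSignedPerm n w ≡ true → SignedPerm n (toList w)
isSignedPerm⇒SignedPerm n w e = record
  { length≡ = length-toList w
  ; inRange = allᵇ⇒All (inRangeᵇ n) (toList w) (proj₁ (∧-true e))
  ; once    = λ j j<n → ≡ᵇ-true⁻ (applyUpTo⁻ _ n (allᵇ⇒All _ (List.upTo n) (proj₂ (∧-true e))) j<n)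
  }

SignedPerm⇒isSignedPerm : ∀ n (w : Vec ℤ n) → SignedPerm n (toList w) → isSignedPerm n w ≡ true
SignedPerm⇒isSignedPerm n w sp = true-∧
  (All⇒allᵇ (inRangeᵇ n) (toList w) (SignedPerm.inRange sp))
  (All⇒allᵇ _ (List.upTo n) (applyUpTo⁺₁ _ n (λ j<n → ≡ᵇ-true (SignedPerm.once sp _ j<n))))

module _ {m : ℕ} {ws : List ℤ} (sp : SignedPerm m ws) where
  open SignedPerm sp

  countᵇ-∣∣≤ : ∀ r → r ≤ m → countᵇ (λ y → ∣ y ∣ ≤ᵇ r) ws ≡ r
  countᵇ-∣∣≤ zero    _   = countᵇ-none (All.map (λ {y} e → ≤ᵇ-false (<⇒≱ (inRange-1≤ y e))) inRange)
  countᵇ-∣∣≤ (suc r) r<m = begin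
    countᵇ (λ y → ∣ y ∣ ≤ᵇ suc r) ws                     ≡⟨ +-identityʳ _ ⟨
    countᵇ (λ y → ∣ y ∣ ≤ᵇ suc r) ws + 0                 ≡⟨ cong (_+_ _) (countᵇ-false ws) ⟨
    countᵇ (λ y → ∣ y ∣ ≤ᵇ suc r) ws + countᵇ (λ _ → false) ws
      ≡⟨ countᵇ-+-cong (All.universal (λ y → ≤ᵇ-suc-split ∣ y ∣) ws) ⟩
    countᵇ (λ y → ∣ y ∣ ≤ᵇ r) ws + multiplicity (suc r) ws ≡⟨ cong₂ _+_ (countᵇ-∣∣≤ r (<⇒≤ r<m)) (once r r<m) ⟩
    r + 1                                                 ≡⟨ +-comm r 1 ⟩
    suc r                                                 ∎
    where
    open ≡-Reasoning
    ≤ᵇ-suc-split : ∀ a → χ (a ≤ᵇ suc r) + 0 ≡ χ (a ≤ᵇ r) + χ (a ≡ᵇ suc r)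
    ≤ᵇ-suc-split a with a ≤? r | a ≟ suc r
    ... | yes a≤r | _ rewrite ≤ᵇ-true (m≤n⇒m≤1+n a≤r) | ≤ᵇ-true a≤r | ≡ᵇ-false (<⇒≢ (s≤s a≤r)) = refl
    ... | no a≰r | yes refl rewrite ≤ᵇ-true (≤-refl {suc r}) | ≤ᵇ-false a≰r | ≡ᵇ-refl (suc r) = refl
    ... | no a≰r | no a≢r rewrite ≤ᵇ-false (a≢r ∘ flip ≤-antisym (≰⇒> a≰r)) | ≤ᵇ-false a≰r | ≡ᵇ-false a≢r = refl

  countᵇ->∣∣ : ∀ r → r ≤ m → countᵇ (λ y → r <ᵇ ∣ y ∣) ws ≡ m ∸ r
  countᵇ->∣∣ r r≤m = trans (sym (m+n∸n≡m _ r)) (cong (_∸ r) (begin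
    countᵇ (λ y → r <ᵇ ∣ y ∣) ws + r                                  ≡⟨ cong (_+_ _) (countᵇ-∣∣≤ r r≤m) ⟨
    countᵇ (λ y → r <ᵇ ∣ y ∣) ws + countᵇ (λ y → ∣ y ∣ ≤ᵇ r) ws
      ≡⟨ countᵇ-+-cong (All.universal (λ y → <ᵇ-or-≥ᵇ ∣ y ∣) ws) ⟩
    countᵇ (λ _ → true) ws + countᵇ (λ _ → false) ws                  ≡⟨ cong₂ _+_ (countᵇ-all ws) (countᵇ-false ws) ⟩
    length ws + 0                                                     ≡⟨ +-identityʳ _ ⟩
    length ws                                                         ≡⟨ length≡ ⟩
    m                                                                 ∎))
    where
    open ≡-Reasoning
    <ᵇ-or-≥ᵇ : ∀ a → χ (r <ᵇ a) + χ (a ≤ᵇ r) ≡ 1 + 0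
    <ᵇ-or-≥ᵇ a with a ≤? r
    ... | yes a≤r rewrite ≤ᵇ-true a≤r | <ᵇ-false (≤⇒≯ a≤r) = refl
    ... | no a≰r rewrite ≤ᵇ-false a≰r | <ᵇ-true (≰⇒> a≰r) = refl

signed : Bool → ℕ → ℤ
signed false r = + suc r
signed true  r = -[1+ r ]

levelWeight : ℕ → Bool → ℕ → ℕ
levelWeight m s r = if s then m + r else m ∸ r

inversionsWith-signed : ∀ {m ws} → SignedPerm m ws → ∀ s {r} → r ≤ m →
                        inversionsWith (signed s r) (List.map (punchInℤ r) ws) ≡ levelWeight m s r
inversionsWith-signed {m} {ws} sp false {r} r≤m = begin
  countᵇ (+ suc r <ℤ_) (List.map (punchInℤ r) ws) + countᵇ (λ x → + suc r <ℤ - x) (List.map (punchInℤ r) ws)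
    ≡⟨ cong₂ _+_ (countᵇ-map _ (punchInℤ r) ws) (countᵇ-map _ (punchInℤ r) ws) ⟩
  countᵇ (λ y → + suc r <ℤ punchInℤ r y) ws + countᵇ (λ y → + suc r <ℤ - punchInℤ r y) ws
    ≡⟨ countᵇ-+-cong (All.map (λ {y} e → larger y (inRange-1≤ y e)) (SignedPerm.inRange sp)) ⟩
  countᵇ (λ y → r <ᵇ ∣ y ∣) ws + countᵇ (λ _ → false) ws
    ≡⟨ cong₂ _+_ (countᵇ->∣∣ sp r r≤m) (countᵇ-false ws) ⟩
  (m ∸ r) + 0
    ≡⟨ +-identityʳ _ ⟩
  m ∸ r ∎
  where
  open ≡-Reasoning
  larger : ∀ y → 1 ≤ ∣ y ∣ →
           χ (+ suc r <ℤ punchInℤ r y) + χ (+ suc r <ℤ - punchInℤ r y) ≡ χ (r <ᵇ ∣ y ∣) + χ false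
  larger (+ suc a) _
    rewrite suc-≤ᵇ (punchIn r a) r | not-≤ᵇ (punchIn r a) r | <ᵇ-punchIn r a | <ᵇ-suc r a = refl
  larger -[1+ a ]  _
    rewrite suc-≤ᵇ (punchIn r a) r | not-≤ᵇ (punchIn r a) r | <ᵇ-punchIn r a | <ᵇ-suc r a = +-comm 0 _
inversionsWith-signed {m} {ws} sp true {r} r≤m = begin
  countᵇ (-[1+ r ] <ℤ_) (List.map (punchInℤ r) ws) + countᵇ (λ x → -[1+ r ] <ℤ - x) (List.map (punchInℤ r) ws)
    ≡⟨ cong₂ _+_ (countᵇ-map _ (punchInℤ r) ws) (countᵇ-map _ (punchInℤ r) ws) ⟩
  countᵇ (λ y → -[1+ r ] <ℤ punchInℤ r y) ws + countᵇ (λ y → -[1+ r ] <ℤ - punchInℤ r y) ws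
    ≡⟨ countᵇ-+-cong (All.map (λ {y} e → smaller y (inRange-1≤ y e)) (SignedPerm.inRange sp)) ⟩
  countᵇ (λ _ → true) ws + countᵇ (λ y → ∣ y ∣ ≤ᵇ r) ws
    ≡⟨ cong₂ _+_ (trans (countᵇ-all ws) (SignedPerm.length≡ sp)) (countᵇ-∣∣≤ sp r r≤m) ⟩
  m + r ∎
  where
  open ≡-Reasoning
  smaller : ∀ y → 1 ≤ ∣ y ∣ →
            χ (-[1+ r ] <ℤ punchInℤ r y) + χ (-[1+ r ] <ℤ - punchInℤ r y) ≡ χ true + χ (∣ y ∣ ≤ᵇ r)
  smaller (+ suc a) _ rewrite not-≤ᵇ r (punchIn r a) | punchIn-<ᵇ r a = refl
  smaller -[1+ a ]  _ rewrite not-≤ᵇ r (punchIn r a) | punchIn-<ᵇ r a = +-comm _ 1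

-- Insertion codes

Option : ℕ → Set
Option j = Bool × Fin j

optionWeight : ∀ j → Option j → ℕ
optionWeight j (s , f) = levelWeight (pred j) s (toℕ f)

-- Levels p d = Option (p + 1) × ⋯ × Option (p + d), nested with the highest level outermost.
Levels : ℕ → ℕ → Set
Levels p zero    = ⊤
Levels p (suc d) = Levels p d × Option (p + suc d)

levelsSum : (∀ j → Option j → ℕ) → ∀ {p} d → Levels p d → ℕ
levelsSum g         zero    tt      = 0
levelsSum g {p = p} (suc d) (l , o) = levelsSum g d l + g (p + suc d) o

-- The option (s , r) at level m+1 records the last entry ±(r+1) of a signed permutation of length m+1.
InsertionCode : ℕ → Set
InsertionCode = Levels 0

decode : ∀ m → InsertionCode m → Vec ℤ m
decode zero    tt          = []
decode (suc m) (c , s , f) = Vec.map (punchInℤ (toℕ f)) (decode m c) ∷ʳ signed s (toℕ f)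

levelsWeight : ∀ {p} d → Levels p d → ℕ
levelsWeight = levelsSum optionWeight

levelsNegatives : ∀ {p} d → Levels p d → ℕ
levelsNegatives = levelsSum (λ _ → χ ∘ proj₁)

toList-decode : ∀ m c s f → toList (decode (suc m) (c , s , f)) ≡
                List.map (punchInℤ (toℕ f)) (toList (decode m c)) ++ signed s (toℕ f) ∷ []
toList-decode m c s f =
  trans (toList-∷ʳ _ (Vec.map (punchInℤ (toℕ f)) (decode m c))) (cong (_++ _) (toList-map _ (decode m c)))

∣signed∣ : ∀ s r → ∣ signed s r ∣ ≡ suc r
∣signed∣ false r = refl
∣signed∣ true  r = refl

signed-<0 : ∀ s r → (signed s r <ℤ + 0) ≡ s
signed-<0 false r = refl
signed-<0 true  r = refl

inRange-punchInℤ : ∀ {m} r y → inRangeᵇ m y ≡ true → inRangeᵇ (suc m) (punchInℤ r y) ≡ true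
inRange-punchInℤ r (+ suc a) e = <ᵇ-true (punchIn-bounded r (inRange-≤ (+ suc a) e))
inRange-punchInℤ r -[1+ a ]  e = <ᵇ-true (punchIn-bounded r (inRange-≤ -[1+ a ] e))

SignedPerm-∷ʳ : ∀ {m ws} → SignedPerm m ws → ∀ s {r} → r ≤ m →
                SignedPerm (suc m) (List.map (punchInℤ r) ws ++ signed s r ∷ [])
SignedPerm-∷ʳ {m} {ws} sp s {r} r≤m = record
  { length≡ = trans (length-++ (List.map (punchInℤ r) ws))
                    (trans (cong (_+ 1) (trans (length-map _ ws) (SignedPerm.length≡ sp))) (+-comm m 1))
  ; inRange = ++⁺ (map⁺ (All.map (λ {y} → inRange-punchInℤ r y) (SignedPerm.inRange sp)))
                  (inRange-intro z (subst (1 ≤_) (sym ∣z∣≡) (s≤s z≤n)) (subst (_≤ suc m) (sym ∣z∣≡) (s≤s r≤m)) ∷ [])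
  ; once    = once
  }
  where
  z = signed s r
  ∣z∣≡ : ∣ z ∣ ≡ suc r
  ∣z∣≡ = ∣signed∣ s r
  once : ∀ j → j < suc m → multiplicity (suc j) (List.map (punchInℤ r) ws ++ z ∷ []) ≡ 1
  once j j<1+m
    rewrite countᵇ-++ (λ x → ∣ x ∣ ≡ᵇ suc j) (List.map (punchInℤ r) ws) (z ∷ [])
          | countᵇ-map (λ x → ∣ x ∣ ≡ᵇ suc j) (punchInℤ r) ws | ∣signed∣ s r
    with j ≟ r
  ... | yes refl
    rewrite countᵇ-none {xs = ws} (All.universal (∣punchInℤ∣≢ r) ws) | ≡ᵇ-refl r = refl
  ... | no j≢r
    rewrite countᵇ-cong {xs = ws} (All.universal (λ y → ∣punchInℤ∣-≡ᵇ r y j≢r) ws)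
          | SignedPerm.once sp (punchOut r j) (punchOut-bounded j<1+m j≢r r≤m)
          | ≡ᵇ-false (j≢r ∘ sym) = refl

SignedPerm-decode : ∀ m c → SignedPerm m (toList (decode m c))
SignedPerm-decode zero    tt          = record { length≡ = refl ; inRange = [] ; once = λ _ () }
SignedPerm-decode (suc m) (c , s , f) rewrite toList-decode m c s f =
  SignedPerm-∷ʳ (SignedPerm-decode m c) s (toℕ≤pred[n] f)

invL-decode : ∀ m c → invL (toList (decode m c)) ≡ levelsWeight m c
invL-decode zero    tt          = refl
invL-decode (suc m) (c , s , f) = begin
  invL (toList (decode (suc m) (c , s , f)))                          ≡⟨ cong invL (toList-decode m c s f) ⟩
  invL (List.map (punchInℤ r) ws ++ signed s r ∷ [])                  ≡⟨ invL-∷ʳ (List.map (punchInℤ r) ws) (signed s r) ⟩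
  invL (List.map (punchInℤ r) ws) + inversionsWith (signed s r) (List.map (punchInℤ r) ws)
    ≡⟨ cong₂ _+_ (trans (invL-punchInℤ r ws) (invL-decode m c))
                 (inversionsWith-signed (SignedPerm-decode m c) s (toℕ≤pred[n] f)) ⟩
  levelsWeight m c + levelWeight m s r                                ∎
  where
  open ≡-Reasoning
  r = toℕ f
  ws = toList (decode m c)

negatives : List ℤ → ℕ
negatives = countᵇ (_<ℤ + 0)

negatives-decode : ∀ m c → negatives (toList (decode m c)) ≡ levelsNegatives m c
negatives-decode zero    tt          = refl
negatives-decode (suc m) (c , s , f)
  rewrite toList-decode m c s f
        | countᵇ-++ (_<ℤ + 0) (List.map (punchInℤ (toℕ f)) (toList (decode m c))) (signed s (toℕ f) ∷ [])
        | countᵇ-map (_<ℤ + 0) (punchInℤ (toℕ f)) (toList (decode m c))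
        | countᵇ-cong {xs = toList (decode m c)} (All.universal (punchInℤ-<0 (toℕ f)) _)
        | negatives-decode m c | signed-<0 s (toℕ f) = cong (_+_ (levelsNegatives m c)) (+-identityʳ (χ s))

-- Saturates at m; only ever applied to r ≤ m.
clamp : (m r : ℕ) → Fin (suc m)
clamp zero    r       = zero
clamp (suc m) zero    = zero
clamp (suc m) (suc r) = suc (clamp m r)

toℕ-clamp : ∀ {m r} → r ≤ m → toℕ (clamp m r) ≡ r
toℕ-clamp {zero}  z≤n     = refl
toℕ-clamp {suc m} z≤n     = refl
toℕ-clamp {suc m} (s≤s p) = cong suc (toℕ-clamp p)

clamp-toℕ : ∀ m (f : Fin (suc m)) → clamp m (toℕ f) ≡ f
clamp-toℕ zero    zero    = refl
clamp-toℕ (suc m) zero    = refl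
clamp-toℕ (suc m) (suc f) = cong suc (clamp-toℕ m f)

encodeWith : ∀ m → (Vec ℤ m → InsertionCode m) → Vec ℤ m → ℤ → InsertionCode (suc m)
encodeWith m enc v z = enc (Vec.map (punchOutℤ r) v) , (z <ℤ + 0) , clamp m r
  where r = pred ∣ z ∣

encode : ∀ m → Vec ℤ m → InsertionCode m
encode zero    _ = tt
encode (suc m) w = encodeWith m (encode m) (init w) (last w)

encode-∷ʳ : ∀ m (v : Vec ℤ m) z → encode (suc m) (v ∷ʳ z) ≡ encodeWith m (encode m) v z
encode-∷ʳ m v z = cong₂ (encodeWith m (encode m)) (init-∷ʳ z v) (last-∷ʳ z v)

map-punchOutℤ-punchInℤ : ∀ {m} r (v : Vec ℤ m) → Vec.map (punchOutℤ r) (Vec.map (punchInℤ r) v) ≡ v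
map-punchOutℤ-punchInℤ r []      = refl
map-punchOutℤ-punchInℤ r (x ∷ v) = cong₂ _∷_ (punchOutℤ-punchInℤ r x) (map-punchOutℤ-punchInℤ r v)

map-punchInℤ-punchOutℤ : ∀ {m} r (v : Vec ℤ m) → All (λ x → ∣ x ∣ ≢ suc r) (toList v) →
                         Vec.map (punchInℤ r) (Vec.map (punchOutℤ r) v) ≡ v
map-punchInℤ-punchOutℤ r []      _        = refl
map-punchInℤ-punchOutℤ r (x ∷ v) (p ∷ ps) = cong₂ _∷_ (punchInℤ-punchOutℤ x p) (map-punchInℤ-punchOutℤ r v ps)

encode-decode : ∀ m c → encode m (decode m c) ≡ c
encode-decode zero    tt          = refl
encode-decode (suc m) (c , s , f) = trans (encode-∷ʳ m _ _) (last-entry s)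
  where
  r = toℕ f
  rest : encode m (Vec.map (punchOutℤ r) (Vec.map (punchInℤ r) (decode m c))) ≡ c
  rest = trans (cong (encode m) (map-punchOutℤ-punchInℤ r (decode m c))) (encode-decode m c)
  last-entry : ∀ s → encodeWith m (encode m) (Vec.map (punchInℤ r) (decode m c)) (signed s r) ≡ (c , s , f)
  last-entry false = cong₂ (λ c′ f′ → c′ , false , f′) rest (clamp-toℕ m f)
  last-entry true  = cong₂ (λ c′ f′ → c′ , true , f′) rest (clamp-toℕ m f)

inRange-punchOutℤ : ∀ {m r} y → r ≤ m → inRangeᵇ (suc m) y ≡ true → ∣ y ∣ ≢ suc r →
                    inRangeᵇ m (punchOutℤ r y) ≡ true
inRange-punchOutℤ (+ suc a) r≤m e h =
  <ᵇ-true (punchOut-bounded (inRange-≤ (+ suc a) e) (h ∘ cong suc) r≤m)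
inRange-punchOutℤ -[1+ a ]  r≤m e h =
  <ᵇ-true (punchOut-bounded (inRange-≤ -[1+ a ] e) (h ∘ cong suc) r≤m)

signed-<0-pred : ∀ z → 1 ≤ ∣ z ∣ → signed (z <ℤ + 0) (pred ∣ z ∣) ≡ z
signed-<0-pred (+ suc a) _ = refl
signed-<0-pred -[1+ a ]  _ = refl

module LastEntry {m} {v : Vec ℤ m} {z : ℤ} (sp : SignedPerm (suc m) (toList v ++ z ∷ [])) where

  r : ℕ
  r = pred ∣ z ∣

  private
    z-inRange : inRangeᵇ (suc m) z ≡ true
    z-inRange = All.head (++⁻ʳ (toList v) (SignedPerm.inRange sp))

    1≤∣z∣ : 1 ≤ ∣ z ∣
    1≤∣z∣ = inRange-1≤ z z-inRange

  ∣z∣≡ : ∣ z ∣ ≡ suc r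
  ∣z∣≡ = sym (suc-pred ∣ z ∣ ⦃ ℕ.>-nonZero 1≤∣z∣ ⦄)

  r≤m : r ≤ m
  r≤m = s≤s⁻¹ (subst (_≤ suc m) ∣z∣≡ (inRange-≤ z z-inRange))

  signed-last : signed (z <ℤ + 0) r ≡ z
  signed-last = signed-<0-pred z 1≤∣z∣

  private
    multiplicity-∷ʳ : ∀ j → multiplicity j (toList v ++ z ∷ []) ≡ multiplicity j (toList v) + χ (∣ z ∣ ≡ᵇ j)
    multiplicity-∷ʳ j =
      trans (countᵇ-++ _ (toList v) (z ∷ [])) (cong (_+_ (multiplicity j (toList v))) (+-identityʳ _))

  others≢ : All (λ x → ∣ x ∣ ≢ suc r) (toList v)
  others≢ = All.map (λ e q → true≢false (trans (sym (≡ᵇ-true q)) e)) (countᵇ-none⁻ _ (toList v) none)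
    where
    none : multiplicity (suc r) (toList v) ≡ 0
    none = +-cancelʳ-≡ 1 _ 0 (begin
      multiplicity (suc r) (toList v) + 1                         ≡⟨ cong (λ b → multiplicity (suc r) (toList v) + χ b) z-counted ⟨
      multiplicity (suc r) (toList v) + χ (∣ z ∣ ≡ᵇ suc r)        ≡⟨ multiplicity-∷ʳ (suc r) ⟨
      multiplicity (suc r) (toList v ++ z ∷ [])                   ≡⟨ SignedPerm.once sp r (s≤s r≤m) ⟩
      1                                                           ∎)
      where
      open ≡-Reasoning
      z-counted : (∣ z ∣ ≡ᵇ suc r) ≡ true
      z-counted = trans (cong (_≡ᵇ suc r) ∣z∣≡) (≡ᵇ-refl (suc r))

  punchedOut : SignedPerm m (toList (Vec.map (punchOutℤ r) v))
  punchedOut rewrite toList-map (punchOutℤ r) v = record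
    { length≡ = trans (length-map _ (toList v)) (length-toList v)
    ; inRange = map⁺ (All.zipWith (λ {x} (e , h) → inRange-punchOutℤ x r≤m e h)
                                  (++⁻ˡ (toList v) (SignedPerm.inRange sp) , others≢))
    ; once    = once
    }
    where
    once : ∀ j → j < m → multiplicity (suc j) (List.map (punchOutℤ r) (toList v)) ≡ 1
    once j j<m = begin
      multiplicity (suc j) (List.map (punchOutℤ r) (toList v))
        ≡⟨ countᵇ-map _ (punchOutℤ r) (toList v) ⟩
      countᵇ (λ x → ∣ punchOutℤ r x ∣ ≡ᵇ suc j) (toList v)
        ≡⟨ countᵇ-cong (All.map (λ {x} → ∣punchOutℤ∣-≡ᵇ r x j) others≢) ⟩
      multiplicity (suc (punchIn r j)) (toList v)
        ≡⟨ +-identityʳ _ ⟨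
      multiplicity (suc (punchIn r j)) (toList v) + 0
        ≡⟨ cong (λ b → multiplicity (suc (punchIn r j)) (toList v) + χ b) z-missed ⟨
      multiplicity (suc (punchIn r j)) (toList v) + χ (∣ z ∣ ≡ᵇ suc (punchIn r j))
        ≡⟨ multiplicity-∷ʳ (suc (punchIn r j)) ⟨
      multiplicity (suc (punchIn r j)) (toList v ++ z ∷ [])
        ≡⟨ SignedPerm.once sp (punchIn r j) (punchIn-bounded r j<m) ⟩
      1 ∎
      where
      open ≡-Reasoning
      z-missed : (∣ z ∣ ≡ᵇ suc (punchIn r j)) ≡ false
      z-missed = trans (cong (_≡ᵇ suc (punchIn r j)) ∣z∣≡) (≡ᵇ-false (punchIn≢ r j ∘ sym ∘ suc-injective))

decode-encode : ∀ m (w : Vec ℤ m) → SignedPerm m (toList w) → decode m (encode m w) ≡ w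
decode-encode zero    []              _  = refl
decode-encode (suc m) w sp with initLast w
decode-encode (suc m) .(v ∷ʳ z) sp | v , z , refl = begin
  Vec.map (punchInℤ (toℕ (clamp m r))) (decode m (encode m (Vec.map (punchOutℤ r) v)))
    ∷ʳ signed (z <ℤ + 0) (toℕ (clamp m r))
    ≡⟨ cong (λ k → Vec.map (punchInℤ k) (decode m (encode m (Vec.map (punchOutℤ r) v))) ∷ʳ signed (z <ℤ + 0) k) (toℕ-clamp r≤m) ⟩
  Vec.map (punchInℤ r) (decode m (encode m (Vec.map (punchOutℤ r) v))) ∷ʳ signed (z <ℤ + 0) r
    ≡⟨ cong₂ (λ u y → Vec.map (punchInℤ r) u ∷ʳ y) (decode-encode m _ punchedOut) signed-last ⟩
  Vec.map (punchInℤ r) (Vec.map (punchOutℤ r) v) ∷ʳ z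
    ≡⟨ cong (_∷ʳ z) (map-punchInℤ-punchOutℤ r v others≢) ⟩
  v ∷ʳ z ∎
  where
  open ≡-Reasoning
  open LastEntry (subst (SignedPerm (suc m)) (toList-∷ʳ z v) sp)

castOption : ∀ {a b} → a ≡ b → Option a → Option b
castOption = subst Option

peel : ∀ p d → Levels p (suc d) → Option (suc p) × Levels (suc p) d
peel p zero    (tt , o) = castOption (+-comm p 1) o , tt
peel p (suc d) (l , o)  = proj₁ (peel p d l) , proj₂ (peel p d l) , castOption (+-suc p (suc d)) o

unpeel : ∀ p d → Option (suc p) × Levels (suc p) d → Levels p (suc d)
unpeel p zero    (o₁ , tt)     = tt , castOption (sym (+-comm p 1)) o₁
unpeel p (suc d) (o₁ , l , o) = unpeel p d (o₁ , l) , castOption (sym (+-suc p (suc d))) o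

peel-unpeel : ∀ p d x → peel p d (unpeel p d x) ≡ x
peel-unpeel p zero    (o₁ , tt)    = cong (_, tt) (subst-subst-sym (+-comm p 1))
peel-unpeel p (suc d) (o₁ , l , o) rewrite peel-unpeel p d (o₁ , l) =
  cong (λ o′ → o₁ , l , o′) (subst-subst-sym (+-suc p (suc d)))

unpeel-peel : ∀ p d l → unpeel p d (peel p d l) ≡ l
unpeel-peel p zero    (tt , o) = cong (tt ,_) (subst-sym-subst (+-comm p 1))
unpeel-peel p (suc d) (l , o) rewrite unpeel-peel p d l =
  cong (l ,_) (subst-sym-subst (+-suc p (suc d)))

castOption-invariant : ∀ (g : ∀ j → Option j → ℕ) {a b} (e : a ≡ b) o → g a o ≡ g b (castOption e o)
castOption-invariant g refl o = refl

levelsSum-peel : ∀ g p d (l : Levels p (suc d)) →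
                 levelsSum g (suc d) l ≡ g (suc p) (proj₁ (peel p d l)) + levelsSum g d (proj₂ (peel p d l))
levelsSum-peel g p zero    (tt , o) = trans (castOption-invariant g (+-comm p 1) o) (sym (+-identityʳ _))
levelsSum-peel g p (suc d) (l , o) = begin
  levelsSum g (suc d) l + g (p + suc (suc d)) o
    ≡⟨ cong₂ _+_ (levelsSum-peel g p d l) (castOption-invariant g (+-suc p (suc d)) o) ⟩
  (g (suc p) o₁ + levelsSum g d l′) + g (suc p + suc d) (castOption (+-suc p (suc d)) o)
    ≡⟨ +-assoc (g (suc p) o₁) _ _ ⟩
  g (suc p) o₁ + (levelsSum g d l′ + g (suc p + suc d) (castOption (+-suc p (suc d)) o)) ∎
  where
  open ≡-Reasoning
  o₁ = proj₁ (peel p d l)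
  l′ = proj₂ (peel p d l)

record WeightedBijection {W A B : Set} (wA : A → W) (wB : B → W) : Set where
  field
    bijection : A ↔ B
    preserves : ∀ a → wB (Inverse.to bijection a) ≡ wA a
  open Inverse bijection public

weighted-trans : ∀ {W A B C : Set} {wA : A → W} {wB : B → W} {wC : C → W} →
                 WeightedBijection wA wB → WeightedBijection wB wC → WeightedBijection wA wC
weighted-trans f g = record
  { bijection = ↔-trans (WeightedBijection.bijection f) (WeightedBijection.bijection g)
  ; preserves = λ a → trans (WeightedBijection.preserves g _) (WeightedBijection.preserves f a)
  }

Σ-≡-irrelevant : ∀ {A : Set} {P : A → Set} → (∀ {a} (p q : P a) → p ≡ q) →
                 ∀ {a a′} → a ≡ a′ → (p : P a) (q : P a′) → (a , p) ≡ (a′ , q)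
Σ-≡-irrelevant irr refl p q = cong (_ ,_) (irr p q)

fiber-↔ : ∀ {W A B : Set} {wA : A → W} {wB : B → W} (P : W → Set) → (∀ {w} (p q : P w) → p ≡ q) →
          WeightedBijection wA wB → Σ A (P ∘ wA) ↔ Σ B (P ∘ wB)
fiber-↔ {wA = wA} {wB} P irr f = mk↔ₛ′
  (λ (a , pa) → to a , subst P (sym (preserves a)) pa)
  (λ (b , pb) → from b , subst P (trans (cong wB (sym (strictlyInverseˡ b))) (preserves (from b))) pb)
  (λ (b , pb) → Σ-≡-irrelevant irr (strictlyInverseˡ b) _ pb)
  (λ (a , pa) → Σ-≡-irrelevant irr (strictlyInverseʳ a) _ pa)
  where open WeightedBijection f

EvenCode : ℕ → Set
EvenCode n = Σ (InsertionCode n) (λ c → T (evenᵇ (levelsNegatives n c)))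

D↔EvenCode : ∀ n → WeightedBijection {A = D n} {B = EvenCode n} (invD ∘ proj₁) (levelsWeight n ∘ proj₁)
D↔EvenCode n = record
  { bijection = mk↔ₛ′ to from
      (λ (c , q) → Σ-≡-irrelevant T-irrelevant (encode-decode n c) _ q)
      (λ (w , p) → Σ-≡-irrelevant T-irrelevant (decode-encode n w (signedPerm w p)) _ p)
  ; preserves = λ (w , p) → trans (sym (invL-decode n (encode n w)))
                                  (cong (invL ∘ toList) (decode-encode n w (signedPerm w p)))
  }
  where
  signedPerm : ∀ w → T (isDn n w) → SignedPerm n (toList w)
  signedPerm w p = isSignedPerm⇒SignedPerm n w (proj₁ (∧-true (T⇒≡ p)))
  to : D n → EvenCode n
  to (w , p) = encode n w , ≡⇒T (begin
    evenᵇ (levelsNegatives n (encode n w))           ≡⟨ cong evenᵇ (negatives-decode n (encode n w)) ⟨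
    evenᵇ (negatives (toList (decode n (encode n w)))) ≡⟨ cong (evenᵇ ∘ negatives ∘ toList) (decode-encode n w (signedPerm w p)) ⟩
    evenᵇ (negatives (toList w))                   ≡⟨ proj₂ (∧-true {isSignedPerm n w} (T⇒≡ p)) ⟩
    true                                           ∎)
    where open ≡-Reasoning
  from : EvenCode n → D n
  from (c , q) = decode n c , ≡⇒T (true-∧
    (SignedPerm⇒isSignedPerm n (decode n c) (SignedPerm-decode n c))
    (trans (cong evenᵇ (negatives-decode n c)) (T⇒≡ q)))

evenᵇ-suc : ∀ n → evenᵇ (suc n) ≡ not (evenᵇ n)
evenᵇ-suc zero          = refl
evenᵇ-suc (suc zero)    = refl
evenᵇ-suc (suc (suc n)) = evenᵇ-suc n

evenᵇ-χ+ : ∀ s n → evenᵇ (χ s + n) ≡ (s xor evenᵇ n)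
evenᵇ-χ+ false n = refl
evenᵇ-χ+ true  n = evenᵇ-suc n

xor-≡-true : ∀ s b → (s xor b) ≡ true → s ≡ not b
xor-≡-true false true  _ = refl
xor-≡-true true  false _ = refl

not-xor-self : ∀ b → (not b xor b) ≡ true
not-xor-self false = refl
not-xor-self true  = refl

forcedSign : ∀ m → Levels 1 m → Option 1
forcedSign m l = not (evenᵇ (levelsNegatives m l)) , zero

EvenCode↔Levels : ∀ m → WeightedBijection {A = EvenCode (suc m)} {B = Levels 1 m}
                                          (levelsWeight (suc m) ∘ proj₁) (levelsWeight m)
EvenCode↔Levels m = record
  { bijection = mk↔ₛ′ to from (λ l → cong proj₂ (peel-unpeel 0 m (forcedSign m l , l))) from-to
  ; preserves = λ (c , _) → sym (trans (levelsSum-peel optionWeight 0 m c) (level1-free (proj₁ (peel 0 m c)) (proj₂ (peel 0 m c))))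
  }
  where
  evenᵇ-peel : ∀ c → evenᵇ (levelsNegatives (suc m) c) ≡
               (proj₁ (proj₁ (peel 0 m c)) xor evenᵇ (levelsNegatives m (proj₂ (peel 0 m c))))
  evenᵇ-peel c = trans (cong evenᵇ (levelsSum-peel _ 0 m c))
                       (evenᵇ-χ+ (proj₁ (proj₁ (peel 0 m c))) (levelsNegatives m (proj₂ (peel 0 m c))))
  to : EvenCode (suc m) → Levels 1 m
  to (c , _) = proj₂ (peel 0 m c)
  from : Levels 1 m → EvenCode (suc m)
  from l = c , ≡⇒T (trans (evenᵇ-peel c) (trans (cong₂ (λ o l′ → proj₁ o xor evenᵇ (levelsNegatives m l′)) o₁≡ l≡)
                                                (not-xor-self (evenᵇ (levelsNegatives m l)))))
    where
    c = unpeel 0 m (forcedSign m l , l)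
    o₁≡ = cong proj₁ (peel-unpeel 0 m (forcedSign m l , l))
    l≡  = cong proj₂ (peel-unpeel 0 m (forcedSign m l , l))
  from-to : ∀ x → from (to x) ≡ x
  from-to (c , q) = Σ-≡-irrelevant T-irrelevant (trans (cong (λ o → unpeel 0 m (o , proj₂ (peel 0 m c))) forced)
                                                        (unpeel-peel 0 m c)) _ q
    where
    forced : forcedSign m (proj₂ (peel 0 m c)) ≡ proj₁ (peel 0 m c)
    forced with peel 0 m c | evenᵇ-peel c | T⇒≡ q
    ... | (s , zero) , l | e | q′ = cong (_, zero) (sym (xor-≡-true s _ (trans (sym e) q′)))
  level1-free : ∀ o (l : Levels 1 m) → optionWeight 1 o + levelsWeight m l ≡ levelsWeight m l
  level1-free (false , zero) l = refl
  level1-free (true  , zero) l = refl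

-- Admissible factorizations, level by level

Factorizations : ℕ → ℕ → Set
Factorizations n p = Σ (List Factor) (T ∘ validFrom n p)

record ValidHead (n p : ℕ) (i : ℤ) (j : ℕ) (fs : List Factor) : Set where
  field
    p<j  : p < j
    j≤n  : j ≤ n
    -j≤i : ((- (+ j)) ℤ.≤ᵇ i) ≡ true
    i<j  : (i <ℤ (+ j)) ≡ true
    i≢0  : not (i ==ℤ + 0) ≡ true
    rest : validFrom n j fs ≡ true

validHead : ∀ {n p i j fs} → validFrom n p ((i , j) ∷ fs) ≡ true → ValidHead n p i j fs
validHead {p = p} {i} {j} e
  with c₁ , e₁ ← ∧-true e
  with c₂ , e₂ ← ∧-true e₁
  with c₃ , e₃ ← ∧-true e₂
  with c₄ , e₄ ← ∧-true e₃
  with c₅ , c₆ ← ∧-true e₄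
  = record { p<j = <ᵇ-true⁻ {p} c₁ ; j≤n = ≤ᵇ-true⁻ {j} c₂ ; -j≤i = c₃ ; i<j = c₄ ; i≢0 = c₅ ; rest = c₆ }

validHead⁻ : ∀ {n p i j fs} → ValidHead n p i j fs → validFrom n p ((i , j) ∷ fs) ≡ true
validHead⁻ h = true-∧ (<ᵇ-true p<j) (true-∧ (≤ᵇ-true j≤n) (true-∧ -j≤i (true-∧ i<j (true-∧ i≢0 rest))))
  where open ValidHead h

ValidHead-rebase : ∀ {n p p′ i j fs} → p′ < j → ValidHead n p i j fs → ValidHead n p′ i j fs
ValidHead-rebase p′<j h = record { p<j = p′<j ; j≤n = j≤n ; -j≤i = -j≤i ; i<j = i<j ; i≢0 = i≢0 ; rest = rest }
  where open ValidHead h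

validFrom-weaken : ∀ n p fs → validFrom n (suc p) fs ≡ true → validFrom n p fs ≡ true
validFrom-weaken n p []             _ = refl
validFrom-weaken n p ((i , j) ∷ fs) e = validHead⁻ (ValidHead-rebase {p′ = p} (<-trans (n<1+n p) (ValidHead.p<j h)) h)
  where h = validHead {n} {suc p} {i} {j} {fs} e

validFrom-strengthen : ∀ {n p i j fs} → j ≢ suc p → validFrom n p ((i , j) ∷ fs) ≡ true →
                       validFrom n (suc p) ((i , j) ∷ fs) ≡ true
validFrom-strengthen {n} {p} {i} {j} {fs} j≢1+p e = validHead⁻ (ValidHead-rebase {p′ = suc p} (≤∧≢⇒< (ValidHead.p<j h) (j≢1+p ∘ sym)) h)
  where h = validHead {n} {p} {i} {j} {fs} e

consOption : ℕ → Bool → ℕ → List Factor → List Factor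
consOption p false r fs with r ≟ p
... | yes _ = fs
... | no  _ = (+ suc r , suc p) ∷ fs
consOption p true  r fs = (-[1+ r ] , suc p) ∷ fs

consOption-valid : ∀ {n p} s {r fs} → suc p ≤ n → r ≤ p → validFrom n (suc p) fs ≡ true →
                   validFrom n p (consOption p s r fs) ≡ true
consOption-valid {n} {p} false {r} {fs} p<n r≤p v with r ≟ p
... | yes _   = validFrom-weaken n p fs v
... | no  r≢p = validHead⁻ {n} {p} {+ suc r} {suc p} {fs} (record
  { p<j = n<1+n p ; j≤n = p<n ; -j≤i = refl ; i<j = trans (not-≤ᵇ (suc p) (suc r)) (<ᵇ-true (s≤s (≤∧≢⇒< r≤p r≢p)))
  ; i≢0 = refl ; rest = v })
consOption-valid {n} {p} true {r} {fs} p<n r≤p v = validHead⁻ {n} {p} { -[1+ r ]} {suc p} {fs} (record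
  { p<j = n<1+n p ; j≤n = p<n ; -j≤i = ≤ᵇ-true r≤p ; i<j = refl ; i≢0 = refl ; rest = v })

consOption-cost : ∀ p s {r} fs → r ≤ p → sorCost (consOption p s r fs) ≡ + levelWeight p s r ℤ.+ sorCost fs
consOption-cost p false {r} fs r≤p with r ≟ p
... | yes refl = sym (trans (cong (λ k → + k ℤ.+ sorCost fs) (n∸n≡0 r)) (ℤ.+-identityˡ _))
... | no  _    = cong (ℤ._+ sorCost fs) (trans (ℤ.+-identityʳ _) (ℤ.⊖-≥ (s≤s r≤p)))
consOption-cost p true  {r} fs r≤p = cong (ℤ._+ sorCost fs) (begin
  + suc p ℤ.- -[1+ r ] ℤ.- + 2  ≡⟨ ℤ.⊖-≥ (s≤s (subst (1 ≤_) (sym (+-suc p r)) (s≤s z≤n))) ⟩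
  + (suc p + suc r ∸ 2)         ≡⟨ cong (λ k → + (k ∸ 1)) (+-suc p r) ⟩
  + (p + r)                     ∎)
  where open ≡-Reasoning

Factorizations-≡ : ∀ {n p} {x y : Factorizations n p} → proj₁ x ≡ proj₁ y → x ≡ y
Factorizations-≡ {x = _ , v} {_ , v′} e = Σ-≡-irrelevant T-irrelevant e v v′

consHead : ∀ {n p} → suc p ≤ n → Option (suc p) × Factorizations n (suc p) → Factorizations n p
consHead {p = p} p<n ((s , f) , fs , v) =
  consOption p s (toℕ f) fs , ≡⇒T (consOption-valid s p<n (toℕ≤pred[n] f) (T⇒≡ v))

splitHeadWith : ∀ {n p} i j fs → validFrom n p ((i , j) ∷ fs) ≡ true → Dec (j ≡ suc p) →
                Option (suc p) × Factorizations n (suc p)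
splitHeadWith {p = p} i j fs v (no j≢1+p) = (false , fromℕ p) , (i , j) ∷ fs , ≡⇒T (validFrom-strengthen {fs = fs} j≢1+p v)
splitHeadWith {n} {p} (+ zero)  _ fs v (yes refl) =
  ⊥-elim (true≢false (sym (ValidHead.i≢0 (validHead {n} {p} {+ zero} {suc p} {fs} v))))
splitHeadWith {n} {p} (+ suc r) _ fs v (yes refl) =
  (false , clamp p r) , fs , ≡⇒T (ValidHead.rest (validHead {n} {p} {+ suc r} {suc p} {fs} v))
splitHeadWith {n} {p} -[1+ r ]  _ fs v (yes refl) =
  (true  , clamp p r) , fs , ≡⇒T (ValidHead.rest (validHead {n} {p} { -[1+ r ]} {suc p} {fs} v))

splitHead : ∀ {n p} → Factorizations n p → Option (suc p) × Factorizations n (suc p)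
splitHead {p = p} ([] , _)           = (false , fromℕ p) , [] , tt
splitHead {p = p} ((i , j) ∷ fs , v) = splitHeadWith i j fs (T⇒≡ v) (j ≟ suc p)

consOption-none : ∀ p fs → consOption p false (toℕ (fromℕ p)) fs ≡ fs
consOption-none p fs rewrite toℕ-fromℕ p | ≟-diag {p} {p} refl = refl

consOption-transposition : ∀ {p r} fs → r ≢ p → consOption p false r fs ≡ (+ suc r , suc p) ∷ fs
consOption-transposition {p} {r} fs r≢p with r ≟ p
... | yes r≡p = ⊥-elim (r≢p r≡p)
... | no  _   = refl

consHead-splitHead : ∀ {n p} (p<n : suc p ≤ n) x → consHead p<n (splitHead x) ≡ x
consHead-splitHead {p = p} p<n ([] , _) = Factorizations-≡ (consOption-none p [])
consHead-splitHead {p = p} p<n ((i , j) ∷ fs , v) with j ≟ suc p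
... | no _ = Factorizations-≡ (consOption-none p _)
consHead-splitHead {n} {p} p<n ((+ zero , _) ∷ fs , v) | yes refl =
  ⊥-elim (true≢false (sym (ValidHead.i≢0 (validHead {n} {p} {+ zero} {suc p} {fs} (T⇒≡ v)))))
consHead-splitHead {n} {p} p<n ((+ suc r , _) ∷ fs , v) | yes refl =
  Factorizations-≡ (trans (cong (λ k → consOption p false k fs) (toℕ-clamp (<⇒≤ r<p)))
                          (consOption-transposition fs (<⇒≢ r<p)))
  where
  r<p : r < p
  r<p = s≤s⁻¹ (<ᵇ-true⁻ (trans (sym (not-≤ᵇ (suc p) (suc r))) (ValidHead.i<j (validHead {n} {p} {+ suc r} {suc p} {fs} (T⇒≡ v)))))
consHead-splitHead {n} {p} p<n ((-[1+ r ] , _) ∷ fs , v) | yes refl =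
  Factorizations-≡ (cong (λ k → (-[1+ k ] , suc p) ∷ fs) (toℕ-clamp (≤ᵇ-true⁻ {r}
    (ValidHead.-j≤i (validHead {n} {p} { -[1+ r ]} {suc p} {fs} (T⇒≡ v))))))

splitHead-consHead : ∀ {n p} (p<n : suc p ≤ n) y → splitHead (consHead p<n y) ≡ y
splitHead-consHead {p = p} p<n ((false , f) , fs , v) with toℕ f ≟ p
splitHead-consHead {p = p} p<n ((false , f) , [] , v) | yes r≡p =
  cong (λ f′ → (false , f′) , [] , v) (toℕ-injective (trans (toℕ-fromℕ p) (sym r≡p)))
splitHead-consHead {n} {p} p<n ((false , f) , (i , j) ∷ fs , v) | yes r≡p with j ≟ suc p
... | yes j≡1+p = ⊥-elim (<-irrefl (sym j≡1+p) (ValidHead.p<j (validHead {n} {suc p} {i} {j} {fs} (T⇒≡ v))))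
... | no  _     = cong₂ (λ f′ x → (false , f′) , x) (toℕ-injective (trans (toℕ-fromℕ p) (sym r≡p)))
                        (Factorizations-≡ refl)
splitHead-consHead {p = p} p<n ((false , f) , fs , v) | no _ rewrite ≟-diag {suc p} {suc p} refl =
  cong₂ (λ f′ x → (false , f′) , x) (clamp-toℕ p f) (Factorizations-≡ refl)
splitHead-consHead {p = p} p<n ((true , f) , fs , v) rewrite ≟-diag {suc p} {suc p} refl =
  cong₂ (λ f′ x → (true , f′) , x) (clamp-toℕ p f) (Factorizations-≡ refl)

peel-↔ : ∀ p d → Levels p (suc d) ↔ (Option (suc p) × Levels (suc p) d)
peel-↔ p d = mk↔ₛ′ (peel p d) (unpeel p d) (peel-unpeel p d) (unpeel-peel p d)

head-↔ : ∀ {n p} → suc p ≤ n → (Option (suc p) × Factorizations n (suc p)) ↔ Factorizations n p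
head-↔ p<n = mk↔ₛ′ (consHead p<n) splitHead (consHead-splitHead p<n) (splitHead-consHead p<n)

noFactorizationsAbove : ∀ {n p} → n ≤ p → (x : Factorizations n p) → x ≡ ([] , tt)
noFactorizationsAbove n≤p ([] , tt)                  = refl
noFactorizationsAbove {n} {p} n≤p ((i , j) ∷ fs , v) = ⊥-elim (<⇒≱ (<-≤-trans p<j j≤n) n≤p)
  where open ValidHead (validHead {n} {p} {i} {j} {fs} (T⇒≡ v))

Levels↔Factorizations : ∀ d p {n} → p + d ≡ n →
  WeightedBijection {A = Levels p d} {B = Factorizations n p} (+_ ∘ levelsWeight d) (sorCost ∘ proj₁)
Levels↔Factorizations zero p p+0≡n = record
  { bijection = mk↔ₛ′ (λ _ → [] , tt) (λ _ → tt)
      (sym ∘ noFactorizationsAbove (≤-reflexive (trans (sym p+0≡n) (+-identityʳ p)))) (λ _ → refl)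
  ; preserves = λ _ → refl
  }
Levels↔Factorizations (suc d) p {n} p+d+1≡n = record
  { bijection = ↔-trans (peel-↔ p d) (↔-trans (↔-refl ×-↔ IH.bijection) (head-↔ p<n))
  ; preserves = preserves
  }
  where
  module IH = WeightedBijection (Levels↔Factorizations d (suc p) (trans (sym (+-suc p d)) p+d+1≡n))
  p<n : suc p ≤ n
  p<n = ≤-trans (s≤s (m≤m+n p d)) (≤-reflexive (trans (sym (+-suc p d)) p+d+1≡n))
  preserves : ∀ l → sorCost (proj₁ (consHead p<n (proj₁ (peel p d l) , IH.to (proj₂ (peel p d l)))))
                   ≡ + levelsWeight (suc d) l
  preserves l = begin
    sorCost (consOption p s (toℕ f) (proj₁ (IH.to l′)))
      ≡⟨ consOption-cost p s _ (toℕ≤pred[n] f) ⟩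
    + optionWeight (suc p) o ℤ.+ sorCost (proj₁ (IH.to l′))
      ≡⟨ cong (ℤ._+_ (+ optionWeight (suc p) o)) (IH.preserves l′) ⟩
    + optionWeight (suc p) o ℤ.+ + levelsWeight d l′
      ≡⟨ ℤ.pos-+ (optionWeight (suc p) o) _ ⟨
    + (optionWeight (suc p) o + levelsWeight d l′)
      ≡⟨ cong +_ (levelsSum-peel optionWeight p d l) ⟨
    + levelsWeight (suc d) l ∎
    where
    open ≡-Reasoning
    o = proj₁ (peel p d l)
    s = proj₁ o
    f = proj₂ o
    l′ = proj₂ (peel p d l)

-- Products of reflections

==ℤ-true⁻ : ∀ x y → (x ==ℤ y) ≡ true → x ≡ y
==ℤ-true⁻ x y e with c₁ , c₂ ← ∧-true e = ℤ.≤-antisym (ℤ.≤ᵇ⇒≤ (≡⇒T c₁)) (ℤ.≤ᵇ⇒≤ (≡⇒T c₂))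

==ℤ-refl : ∀ x → (x ==ℤ x) ≡ true
==ℤ-refl x = true-∧ x≤ᵇx x≤ᵇx
  where
  x≤ᵇx : (x ℤ.≤ᵇ x) ≡ true
  x≤ᵇx = T⇒≡ (ℤ.≤⇒≤ᵇ (ℤ.≤-refl {x}))

∣∣≢suc : ∀ x k → (x ==ℤ + suc k) ≡ false → (x ==ℤ -[1+ k ]) ≡ false → ∣ x ∣ ≢ suc k
∣∣≢suc (+ suc _) k e _ refl = true≢false (trans (sym (==ℤ-refl (+ suc k))) e)
∣∣≢suc -[1+ _ ]  k _ e refl = true≢false (trans (sym (==ℤ-refl -[1+ k ])) e)

swap : ℕ → ℕ → ℕ → ℕ
swap a b m = if m ≡ᵇ a then b else if m ≡ᵇ b then a else m

module _ {a b : ℕ} where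

  swap-a : swap a b a ≡ b
  swap-a rewrite ≡ᵇ-refl a = refl

  swap-b : a ≢ b → swap a b b ≡ a
  swap-b a≢b rewrite ≡ᵇ-false (a≢b ∘ sym) | ≡ᵇ-refl b = refl

  swap-other : ∀ {m} → m ≢ a → m ≢ b → swap a b m ≡ m
  swap-other m≢a m≢b rewrite ≡ᵇ-false m≢a | ≡ᵇ-false m≢b = refl

  swap-involutive : a ≢ b → ∀ m → swap a b (swap a b m) ≡ m
  swap-involutive a≢b m with m ≟ a
  ... | yes refl rewrite swap-a = swap-b a≢b
  ... | no m≢a with m ≟ b
  ... | yes refl rewrite swap-b a≢b = swap-a
  ... | no m≢b rewrite swap-other m≢a m≢b = swap-other m≢a m≢b

  swap-≡ᵇ : a ≢ b → ∀ m v → (swap a b m ≡ᵇ v) ≡ (m ≡ᵇ swap a b v)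
  swap-≡ᵇ a≢b m v = true⇔⇒≡ _ _
    (λ e → ≡ᵇ-true (trans (sym (swap-involutive a≢b m)) (cong (swap a b) (≡ᵇ-true⁻ {swap a b m} e))))
    (λ e → ≡ᵇ-true (trans (cong (swap a b) (≡ᵇ-true⁻ {m} e)) (swap-involutive a≢b v)))

  swap-preserves : (P : ℕ → Set) → P a → P b → ∀ {m} → P m → P (swap a b m)
  swap-preserves P Pa Pb {m} Pm with m ≟ a
  ... | yes refl rewrite swap-a = Pb
  ... | no m≢a with m ≟ b
  ... | yes refl rewrite ≡ᵇ-false m≢a | ≡ᵇ-refl m = Pa
  ... | no m≢b rewrite swap-other m≢a m≢b = Pm

record SignedAction (n : ℕ) (t : ℤ → ℤ) : Set where
  field
    π          : ℕ → ℕ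
    π-≡ᵇ       : ∀ m v → (π m ≡ᵇ v) ≡ (m ≡ᵇ π v)
    π-inRange  : ∀ {m} → 1 ≤ m → m ≤ n → 1 ≤ π m × π m ≤ n
    flips      : ℕ → Bool
    flips-even : ∀ {ws} → SignedPerm n ws → evenᵇ (countᵇ (flips ∘ ∣_∣) ws) ≡ true
    ∣t∣        : ∀ x → ∣ t x ∣ ≡ π ∣ x ∣
    t-<0       : ∀ x → (t x <ℤ + 0) ≡ ((x <ℤ + 0) xor flips ∣ x ∣)

flipsTwo : ℕ → ℕ → ℕ → Bool
flipsTwo a b m = (m ≡ᵇ a) ∨ (m ≡ᵇ b)

flipsTwo-even : ∀ {n a b ws} → a ≢ b → a < n → b < n → SignedPerm n ws →
                evenᵇ (countᵇ (flipsTwo (suc a) (suc b) ∘ ∣_∣) ws) ≡ true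
flipsTwo-even {n} {a} {b} {ws} a≢b a<n b<n sp = cong evenᵇ (begin
  countᵇ (flipsTwo (suc a) (suc b) ∘ ∣_∣) ws                  ≡⟨ +-identityʳ _ ⟨
  countᵇ (flipsTwo (suc a) (suc b) ∘ ∣_∣) ws + 0              ≡⟨ cong (_+_ _) (countᵇ-false ws) ⟨
  countᵇ (flipsTwo (suc a) (suc b) ∘ ∣_∣) ws + countᵇ (λ _ → false) ws
    ≡⟨ countᵇ-+-cong (All.universal (λ x → ∨-split ∣ x ∣) ws) ⟩
  multiplicity (suc a) ws + multiplicity (suc b) ws           ≡⟨ cong₂ _+_ (SignedPerm.once sp a a<n) (SignedPerm.once sp b b<n) ⟩
  2                                                           ∎)
  where
  open ≡-Reasoning
  ∨-split : ∀ m → χ (flipsTwo (suc a) (suc b) m) + 0 ≡ χ (m ≡ᵇ suc a) + χ (m ≡ᵇ suc b)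
  ∨-split m with m ≟ suc a
  ... | yes refl rewrite ≡ᵇ-refl m | ≡ᵇ-false (a≢b ∘ suc-injective) = refl
  ... | no m≢a   rewrite ≡ᵇ-false m≢a = +-identityʳ _

suc-<⇒≢ : ∀ {a b} → a < b → suc a ≢ suc b
suc-<⇒≢ a<b = <⇒≢ a<b ∘ suc-injective

transposition-acts : ∀ a j′ x → a < j′ → (∣ tAct (+ suc a , suc j′) x ∣ ≡ swap (suc a) (suc j′) ∣ x ∣)
                         × ((tAct (+ suc a , suc j′) x <ℤ + 0) ≡ ((x <ℤ + 0) xor false))
transposition-acts a j′ x a<j′ with x ==ℤ + suc a in e₁
... | true rewrite ==ℤ-true⁻ x _ e₁ = sym (swap-a {suc a}) , refl
... | false with x ==ℤ + suc j′ in e₂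
... | true rewrite ==ℤ-true⁻ x _ e₂ = sym (swap-b (suc-<⇒≢ a<j′)) , refl
... | false with x ==ℤ -[1+ a ] in e₃
... | true rewrite ==ℤ-true⁻ x _ e₃ = sym (swap-a {suc a}) , refl
... | false with x ==ℤ -[1+ j′ ] in e₄
... | true rewrite ==ℤ-true⁻ x _ e₄ = sym (swap-b (suc-<⇒≢ a<j′)) , refl
... | false = sym (swap-other (∣∣≢suc x a e₁ e₃) (∣∣≢suc x j′ e₂ e₄)) , sym (xor-identityʳ _)

signedTransposition-acts : ∀ a j′ x → a < j′ →
  (∣ tAct (-[1+ a ] , suc j′) x ∣ ≡ swap (suc a) (suc j′) ∣ x ∣)
  × ((tAct (-[1+ a ] , suc j′) x <ℤ + 0) ≡ ((x <ℤ + 0) xor flipsTwo (suc a) (suc j′) ∣ x ∣))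
signedTransposition-acts a j′ x a<j′ with -[1+ a ] ==ℤ -[1+ j′ ] in e₀
... | true = ⊥-elim (<⇒≢ a<j′ (ℤ.-[1+-injective (==ℤ-true⁻ _ _ e₀)))
... | false with x ==ℤ -[1+ a ] in e₁
... | true rewrite ==ℤ-true⁻ x _ e₁ | ≡ᵇ-refl a = refl , refl
... | false with x ==ℤ + suc j′ in e₂
... | true rewrite ==ℤ-true⁻ x _ e₂ =
  sym (swap-b (suc-<⇒≢ a<j′)) , sym (trans (cong (_∨_ (j′ ≡ᵇ a)) (≡ᵇ-refl j′)) (∨-zeroʳ _))
... | false with x ==ℤ + suc a in e₃
... | true rewrite ==ℤ-true⁻ x _ e₃ | ≡ᵇ-refl a = refl , refl
... | false with x ==ℤ -[1+ j′ ] in e₄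
... | true rewrite ==ℤ-true⁻ x _ e₄ =
  sym (swap-b (suc-<⇒≢ a<j′)) , sym (cong not (trans (cong (_∨_ (j′ ≡ᵇ a)) (≡ᵇ-refl j′)) (∨-zeroʳ _)))
... | false rewrite ≡ᵇ-false (∣∣≢suc x a e₃ e₁) | ≡ᵇ-false (∣∣≢suc x j′ e₂ e₄) = refl , sym (xor-identityʳ _)

signFlip-acts : ∀ j′ x → (∣ tAct (-[1+ j′ ] , suc j′) x ∣ ≡ ∣ x ∣)
                       × ((tAct (-[1+ j′ ] , suc j′) x <ℤ + 0) ≡ ((x <ℤ + 0) xor flipsTwo 1 (suc j′) ∣ x ∣))
signFlip-acts j′ x with -[1+ j′ ] ==ℤ -[1+ j′ ] in e₀
... | false = ⊥-elim (true≢false (trans (sym (==ℤ-refl -[1+ j′ ])) e₀))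
... | true with x ==ℤ + 1 in e₁
... | true rewrite ==ℤ-true⁻ x _ e₁ = refl , refl
... | false with x ==ℤ -[1+ 0 ] in e₂
... | true rewrite ==ℤ-true⁻ x _ e₂ = refl , refl
... | false with x ==ℤ + suc j′ in e₃
... | true rewrite ==ℤ-true⁻ x _ e₃ | ≡ᵇ-refl j′ | ∨-zeroʳ (j′ ≡ᵇ 0) = refl , refl
... | false with x ==ℤ -[1+ j′ ] in e₄
... | true rewrite ==ℤ-true⁻ x _ e₄ | ≡ᵇ-refl j′ | ∨-zeroʳ (j′ ≡ᵇ 0) = refl , refl
... | false rewrite ≡ᵇ-false (∣∣≢suc x 0 e₁ e₂) | ≡ᵇ-false (∣∣≢suc x j′ e₃ e₄) = refl , sym (xor-identityʳ _)

swap-inRange : ∀ {n a b m} → 1 ≤ a → a ≤ n → 1 ≤ b → b ≤ n → 1 ≤ m → m ≤ n →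
               1 ≤ swap a b m × swap a b m ≤ n
swap-inRange 1≤a a≤n 1≤b b≤n 1≤m m≤n =
  swap-preserves (λ k → 1 ≤ k × k ≤ _) (1≤a , a≤n) (1≤b , b≤n) (1≤m , m≤n)

transpositionAction : ∀ {n a j′} → a < j′ → suc j′ ≤ n → SignedAction n (tAct (+ suc a , suc j′))
transpositionAction {a = a} {j′} a<j′ j<n = record
  { π          = swap (suc a) (suc j′)
  ; π-≡ᵇ       = swap-≡ᵇ (suc-<⇒≢ a<j′)
  ; π-inRange  = swap-inRange (s≤s z≤n) (≤-trans (s≤s (<⇒≤ a<j′)) j<n) (s≤s z≤n) j<n
  ; flips      = λ _ → false
  ; flips-even = λ {ws} _ → cong evenᵇ (countᵇ-false ws)
  ; ∣t∣        = λ x → proj₁ (transposition-acts a j′ x a<j′)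
  ; t-<0       = λ x → proj₂ (transposition-acts a j′ x a<j′)
  }

signedTranspositionAction : ∀ {n a j′} → a < j′ → suc j′ ≤ n → SignedAction n (tAct (-[1+ a ] , suc j′))
signedTranspositionAction {a = a} {j′} a<j′ j<n = record
  { π          = swap (suc a) (suc j′)
  ; π-≡ᵇ       = swap-≡ᵇ (suc-<⇒≢ a<j′)
  ; π-inRange  = swap-inRange (s≤s z≤n) (≤-trans (s≤s (<⇒≤ a<j′)) j<n) (s≤s z≤n) j<n
  ; flips      = flipsTwo (suc a) (suc j′)
  ; flips-even = flipsTwo-even (<⇒≢ a<j′) (<-trans a<j′ j<n) j<n
  ; ∣t∣        = λ x → proj₁ (signedTransposition-acts a j′ x a<j′)
  ; t-<0       = λ x → proj₂ (signedTransposition-acts a j′ x a<j′)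
  }

signFlipAction : ∀ {n j′} → 1 ≤ j′ → suc j′ ≤ n → SignedAction n (tAct (-[1+ j′ ] , suc j′))
signFlipAction {j′ = j′} 1≤j′ j<n = record
  { π          = λ m → m
  ; π-≡ᵇ       = λ _ _ → refl
  ; π-inRange  = _,_
  ; flips      = flipsTwo 1 (suc j′)
  ; flips-even = flipsTwo-even (<⇒≢ 1≤j′) (<-trans 1≤j′ j<n) j<n
  ; ∣t∣        = λ x → proj₁ (signFlip-acts j′ x)
  ; t-<0       = λ x → proj₂ (signFlip-acts j′ x)
  }

reflectionAction : ∀ {n p i j fs} → 1 ≤ p → ValidHead n p i j fs → SignedAction n (tAct (i , j))
reflectionAction {j = zero}  1≤p h = ⊥-elim (<⇒≱ (ValidHead.p<j h) z≤n)
reflectionAction {j = suc zero} 1≤p h = ⊥-elim (<⇒≱ (ValidHead.p<j h) 1≤p)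
reflectionAction {i = + zero} {suc (suc _)} 1≤p h = ⊥-elim (true≢false (sym (ValidHead.i≢0 h)))
reflectionAction {i = + suc a} {suc (suc j)} 1≤p h = transpositionAction a<j+1 (ValidHead.j≤n h)
  where
  a<j+1 : a < suc j
  a<j+1 = s≤s⁻¹ (<ᵇ-true⁻ (trans (sym (not-≤ᵇ (suc (suc j)) (suc a))) (ValidHead.i<j h)))
reflectionAction {i = -[1+ a ]} {suc (suc j)} 1≤p h with a ≟ suc j
... | yes refl = signFlipAction (s≤s z≤n) (ValidHead.j≤n h)
... | no a≢j+1 = signedTranspositionAction (≤∧≢⇒< (≤ᵇ-true⁻ (ValidHead.-j≤i h)) a≢j+1) (ValidHead.j≤n h)

oddᵇ : ℕ → Bool
oddᵇ n = not (evenᵇ n)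

oddᵇ-χ+ : ∀ s n → oddᵇ (χ s + n) ≡ (s xor oddᵇ n)
oddᵇ-χ+ false n = refl
oddᵇ-χ+ true  n = cong not (evenᵇ-suc n)

oddᵇ-countᵇ-xor : ∀ {A : Set} (p q : A → Bool) xs →
                  oddᵇ (countᵇ (λ x → p x xor q x) xs) ≡ (oddᵇ (countᵇ p xs) xor oddᵇ (countᵇ q xs))
oddᵇ-countᵇ-xor p q []       = refl
oddᵇ-countᵇ-xor p q (x ∷ xs)
  rewrite oddᵇ-χ+ (p x xor q x) (countᵇ (λ x → p x xor q x) xs) | oddᵇ-countᵇ-xor p q xs
        | oddᵇ-χ+ (p x) (countᵇ p xs) | oddᵇ-χ+ (q x) (countᵇ q xs) =
  xor-interchange (p x) (q x) (oddᵇ (countᵇ p xs)) (oddᵇ (countᵇ q xs))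

module _ {n t} (act : SignedAction n t) where
  open SignedAction act

  SignedPerm-act : ∀ {ws} → SignedPerm n ws → SignedPerm n (List.map t ws)
  SignedPerm-act {ws} sp = record
    { length≡ = trans (length-map t ws) (SignedPerm.length≡ sp)
    ; inRange = map⁺ (All.map (λ {y} e → inRange-act y (π-inRange (inRange-1≤ y e) (inRange-≤ y e)))
                              (SignedPerm.inRange sp))
    ; once    = λ k k<n → begin
        multiplicity (suc k) (List.map t ws)                ≡⟨ countᵇ-map _ t ws ⟩
        countᵇ (λ x → ∣ t x ∣ ≡ᵇ suc k) ws                  ≡⟨ countᵇ-cong (All.universal (λ x →
                                                               trans (cong (_≡ᵇ suc k) (∣t∣ x)) (π-≡ᵇ ∣ x ∣ (suc k))) ws) ⟩
        multiplicity (π (suc k)) ws                         ≡⟨ once-π k<n ⟩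
        1                                                   ∎
    }
    where
    open ≡-Reasoning
    inRange-act : ∀ y → 1 ≤ π ∣ y ∣ × π ∣ y ∣ ≤ n → inRangeᵇ n (t y) ≡ true
    inRange-act y (1≤ , ≤n) = inRange-intro (t y) (subst (1 ≤_) (sym (∣t∣ y)) 1≤) (subst (_≤ n) (sym (∣t∣ y)) ≤n)
    once-π : ∀ {k} → k < n → multiplicity (π (suc k)) ws ≡ 1
    once-π {k} k<n with π-inRange (s≤s (z≤n {k})) k<n
    ... | 1≤ , ≤n = trans (cong (λ v → multiplicity v ws) (sym (suc-pred _ ⦃ ℕ.>-nonZero 1≤ ⦄)))
                          (SignedPerm.once sp (pred (π (suc k))) (subst (_≤ n) (sym (suc-pred _ ⦃ ℕ.>-nonZero 1≤ ⦄)) ≤n))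

  evenᵇ-negatives-act : ∀ {ws} → SignedPerm n ws → evenᵇ (negatives (List.map t ws)) ≡ evenᵇ (negatives ws)
  evenᵇ-negatives-act {ws} sp = not-injective (begin
    oddᵇ (negatives (List.map t ws))                            ≡⟨ cong oddᵇ (countᵇ-map _ t ws) ⟩
    oddᵇ (countᵇ (λ x → t x <ℤ + 0) ws)                         ≡⟨ cong oddᵇ (countᵇ-cong (All.universal t-<0 ws)) ⟩
    oddᵇ (countᵇ (λ x → (x <ℤ + 0) xor flips ∣ x ∣) ws)          ≡⟨ oddᵇ-countᵇ-xor _ _ ws ⟩
    oddᵇ (negatives ws) xor oddᵇ (countᵇ (flips ∘ ∣_∣) ws)      ≡⟨ cong (λ b → oddᵇ (negatives ws) xor not b) (flips-even sp) ⟩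
    oddᵇ (negatives ws) xor false                               ≡⟨ xor-identityʳ _ ⟩
    oddᵇ (negatives ws)                                         ∎)
    where open ≡-Reasoning

ascending : ℕ → ℕ → List ℤ
ascending k zero    = []
ascending k (suc n) = + suc k ∷ ascending (suc k) n

toList-identity : ∀ k n → toList (tabulate {n = n} (λ p → + suc (k + toℕ p))) ≡ ascending k n
toList-identity k zero    = refl
toList-identity k (suc n) = cong₂ _∷_ (cong (λ a → + suc a) (+-identityʳ k))
  (trans (cong toList (tabulate-cong (λ p → cong (λ a → + suc a) (+-suc k (toℕ p))))) (toList-identity (suc k) n))

ascending-bounds : ∀ k n → All (λ x → k < ∣ x ∣ × ∣ x ∣ ≤ k + n) (ascending k n)
ascending-bounds k zero    = []
ascending-bounds k (suc n) = (≤-refl , subst (suc k ≤_) (sym (+-suc k n)) (s≤s (m≤m+n k n)))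
  ∷ All.map (λ (k+1< , ≤k+1+n) → <-trans (n<1+n k) k+1< , ≤-trans ≤k+1+n (≤-reflexive (sym (+-suc k n))))
            (ascending-bounds (suc k) n)

ascending-length : ∀ k n → length (ascending k n) ≡ n
ascending-length k zero    = refl
ascending-length k (suc n) = cong suc (ascending-length (suc k) n)

ascending-nonnegative : ∀ k n → All (λ x → (x <ℤ + 0) ≡ false) (ascending k n)
ascending-nonnegative k zero    = []
ascending-nonnegative k (suc n) = refl ∷ ascending-nonnegative (suc k) n

ascending-once : ∀ k n j → j < n → multiplicity (suc (k + j)) (ascending k n) ≡ 1
ascending-once k (suc n) zero    _ = cong₂ _+_
  (cong χ (≡ᵇ-true (cong suc (sym (+-identityʳ k)))))
  (countᵇ-none (All.map (λ {x} (k+1<x , _) → ≡ᵇ-false (λ x≡ → <-irrefl (trans (cong suc (sym (+-identityʳ k))) (sym x≡)) k+1<x))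
                        (ascending-bounds (suc k) n)))
ascending-once k (suc n) (suc j) (s≤s j<n)
  rewrite ≡ᵇ-false {k} {k + suc j} (λ e → <-irrefl (trans (+-identityʳ k) e) (+-monoʳ-< k (s≤s z≤n)))
        | +-suc k j = ascending-once (suc k) n j j<n

identity : ∀ n → Vec ℤ n
identity n = tabulate (λ p → + suc (toℕ p))

identity∈D : ∀ n → isDn n (identity n) ≡ true
identity∈D n = true-∧
  (SignedPerm⇒isSignedPerm n (identity n) (subst (SignedPerm n) (sym (toList-identity 0 n)) (record
    { length≡ = ascending-length 0 n
    ; inRange = All.map (λ {x} (0<x , x≤n) → inRange-intro x 0<x x≤n) (ascending-bounds 0 n)
    ; once    = ascending-once 0 n
    })))
  (cong evenᵇ (trans (cong negatives (toList-identity 0 n)) (countᵇ-none (ascending-nonnegative 0 n))))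

prodVec-∷ : ∀ n f fs → prodVec n (f ∷ fs) ≡ Vec.map (tAct f) (prodVec n fs)
prodVec-∷ n f fs = tabulate-∘ (tAct f) (λ p → prodAct fs (+ suc (toℕ p)))

prodVec∈D : ∀ n {p} fs → 1 ≤ p → validFrom n p fs ≡ true → isDn n (prodVec n fs) ≡ true
prodVec∈D n []             _   _ = identity∈D n
prodVec∈D n {p} ((i , j) ∷ fs) 1≤p v rewrite prodVec-∷ n (i , j) fs = true-∧
  (SignedPerm⇒isSignedPerm n _ (subst (SignedPerm n) (sym (toList-map (tAct (i , j)) w)) (SignedPerm-act act sp)))
  (trans (cong (evenᵇ ∘ negatives) (toList-map (tAct (i , j)) w))
         (trans (evenᵇ-negatives-act act sp) (proj₂ (∧-true {isSignedPerm n w} w∈D))))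
  where
  h = validHead {n} {p} {i} {j} {fs} v
  w = prodVec n fs
  w∈D = prodVec∈D n fs (≤-trans 1≤p (<⇒≤ (ValidHead.p<j h))) (ValidHead.rest h)
  sp = isSignedPerm⇒SignedPerm n w (proj₁ (∧-true w∈D))
  act = reflectionAction 1≤p h

SorFiber↔ : ∀ n k → SorFiber n k ↔ Σ (Factorizations n 1) (λ x → sorCost (proj₁ x) ≡ + k)
SorFiber↔ n k = mk↔ₛ′
  (λ (_ , fs , v , _ , c) → (fs , v) , c)
  (λ ((fs , v) , c) → (prodVec n fs , ≡⇒T (prodVec∈D n fs (s≤s z≤n) (T⇒≡ v))) , fs , v , refl , c)
  (λ _ → refl)
  (λ { ((_ , w∈D) , fs , v , refl , c) → cong (λ w∈D′ → (prodVec n fs , w∈D′) , fs , v , refl , c) (T-irrelevant _ _) })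

Σ-≡-+↔ : ∀ {A : Set} (w : A → ℕ) k → Σ A (λ a → w a ≡ k) ↔ Σ A (λ a → + w a ≡ + k)
Σ-≡-+↔ w k = mk↔ₛ′ (λ (a , e) → a , cong +_ e) (λ (a , e) → a , ℤ.+-injective e)
  (λ (a , e) → cong (a ,_) (Decidable⇒UIP.≡-irrelevant ℤ._≟_ _ e)) (λ (a , e) → cong (a ,_) (≡-irrelevant _ e))

-- The argument works for every n ≥ 1.
corollary4p5 : (n : ℕ) → 4 ≤ n → (k : ℕ) → InvFiber n k ↔ SorFiber n k
corollary4p5 (suc m) _ k =
  ↔-trans (fiber-↔ (_≡ k) ≡-irrelevant (weighted-trans (D↔EvenCode (suc m)) (EvenCode↔Levels m)))
  (↔-trans (Σ-≡-+↔ (levelsWeight m) k)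
  (↔-trans (fiber-↔ (_≡ + k) (Decidable⇒UIP.≡-irrelevant ℤ._≟_) (Levels↔Factorizations m 1 refl))
           (↔-sym (SorFiber↔ (suc m) k))))
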